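{- Let $\mathbb{A}=\mathbb{F}_2[x]$ and $\mathbb{M}$ the set of monic polynomials in $\mathbb{A}$. For non-constant $f\in\mathbb{A}$ let $\Phi(f)=|(\mathbb{A}/f\mathbb{A})^*|$, and for a positive integer $n$ let $\Phi^{ -1}(n)\cap\mathbb{M}$ be the set of non-constant monic $f$ with $\Phi(f)=n$. Then for every integer $l\ge 3$ there exists a positive integer $n$ such that $|\Phi^{ -1}(n)\cap\mathbb{M}|=l$. -}

module Defs where

open import Data.Bool using (Bool; true; false; if_then_else_; _xor_)
open import Data.Bool.Properties using () renaming (_≟_ to _≟ᵇ_)
open import Data.Nat using (ℕ; zero; suc)
open import Data.Vec using (Vec; []; _∷_; replicate; zipWith; last; init)
open import Data.Vec.Properties using (≡-dec)
open import Data.List using (List; []; _∷_; concatMap; filter; length)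
open import Data.List.Relation.Unary.Any using (Any; any?)
open import Data.Product using (Σ; _,_)
open import Relation.Binary.PropositionalEquality using (_≡_)
open import Relation.Nullary using (Dec)

-- A non-constant monic polynomial in F₂[x] of degree (suc k):
--   (k , c)  represents  f = x^(suc k) + Σ_{i ≤ k} c_i x^i ,
-- with c the vector of lower coefficients (lowest degree first).
-- This representation is canonical (bijective), so ≡ is equality of polynomials.
MonicNC : Set
MonicNC = Σ ℕ (λ k → Vec Bool (suc k))

allVecs : (n : ℕ) → List (Vec Bool n)
allVecs zero    = [] ∷ []
allVecs (suc n) = concatMap (λ v → (false ∷ v) ∷ (true ∷ v) ∷ []) (allVecs n)

-- Arithmetic in the quotient ring A/fA, f = x^d + Σ c_i x^i, whose elements are
-- represented by their unique remainders of degree < d (coefficient vectors of length d).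
module Quot {k : ℕ} (c : Vec Bool (suc k)) where
  Res : Set
  Res = Vec Bool (suc k)

  addR : Res → Res → Res
  addR = zipWith _xor_

  zeroR : Res
  zeroR = replicate (suc k) false

  oneR : Res
  oneR = true ∷ replicate k false

  -- multiplication by x modulo f
  mulX : Res → Res
  mulX v = if last w then zipWith _xor_ (init w) c else init w
    where
      w : Vec Bool (suc (suc k))
      w = false ∷ v

  mulPoly : ∀ {m} → Vec Bool m → Res → Res
  mulPoly []       s = zeroR
  mulPoly (a ∷ r) s = addR (if a then s else zeroR) (mulX (mulPoly r s))

  mulR : Res → Res → Res
  mulR = mulPoly

  IsUnit : Res → Set
  IsUnit r = Any (λ s → mulR r s ≡ oneR) (allVecs (suc k))

  isUnit? : (r : Res) → Dec (IsUnit r)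
  isUnit? r = any? (λ s → ≡-dec _≟ᵇ_ (mulR r s) oneR) (allVecs (suc k))

  units : List Res
  units = filter isUnit? (allVecs (suc k))

Φ : MonicNC → ℕ
Φ (k , c) = length (Quot.units c)

{-# OPTIONS --safe #-}
module Submission where

-- Write ξ for the class of x in A/fA. For f = x^a (x+1)^b (a + b ≥ 1) a residue r is a unit
-- iff r(0) = 1 (when a > 0) and r(1) = 1 (when b > 0): necessity by evaluation, sufficiency
-- because r + 1 is then a multiple of the nilpotent ξ, ξ + 1 or ξ(ξ + 1), and in characteristic
-- two 1 + (nilpotent) is a unit by the Frobenius map. Counting residues gives
-- Φ(x^a (x+1)^b) = 2^((a-1)⁺ + (b-1)⁺).
--
-- Conversely, if Φ(f) = 2^m then u^(2^m) = 1 for every unit u, and this forces s = ξ(ξ + 1) to be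
-- nilpotent: some power e of s is idempotent, u = 1 + e + eξ is a unit with u + 1 = e(ξ + 1), so
-- e(ξ + 1)^(2^m) = (u + 1)^(2^m) = u^(2^m) + 1 = 0, whence e = 0. Nilpotence of s passes from
-- A/(xg) and A/((x+1)g) down to A/g, and it fails when f(0) = f(1) = 1 since then ξ and ξ + 1 are
-- units; by induction on the degree, f = x^a (x+1)^b. Hence the monic f with Φ(f) = 2^m are the
-- m + 3 polynomials x^a (x+1)^b with (a-1)⁺ + (b-1)⁺ = m, and n = 2^(l-3) has exactly l preimages.

open import Defs
open import Data.Nat using (ℕ; _≤_)
open import Data.List using (List; length)
open import Data.List.Relation.Unary.Unique.Propositional using (Unique)
open import Data.List.Membership.Propositional using (_∈_)
open import Data.Product using (_×_; ∃-syntax)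
open import Relation.Binary.PropositionalEquality using (_≡_)

open import Algebra.Bundles using (AbelianGroup; CommutativeMonoid; CommutativeRing)
open import Algebra.Core using (Op₂)
import Algebra.Properties.CommutativeSemigroup as CommutativeSemigroupProperties
import Algebra.Properties.Group as GroupProperties
open import Algebra.Structures using (IsAbelianGroup; IsCommutativeMonoid; IsCommutativeRing)
open import Data.Bool using (Bool; true; false; if_then_else_; _xor_; _∧_; not)
open import Data.Bool.Properties
  using (not-involutive; ∧-conicalˡ; ∧-zeroʳ; ∧-identityʳ; ∧-distribʳ-xor;
         xor-assoc; xor-comm; xor-same; xor-identityˡ; xor-identityʳ; xor-∧-commutativeRing)
  renaming (_≟_ to _≟ᵇ_)
open import Data.Empty using (⊥-elim)
open import Data.Fin using (toℕ)
open import Data.Fin.Properties using (pigeonhole)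
open import Data.List using ([]; _∷_; map; foldr; lookup; filter; concatMap; upTo)
open import Data.List.Properties using (length-map; length-upTo; filter-accept; filter-reject; filter-all; filter-≐)
open import Data.List.Membership.Propositional.Properties
  using (∈-map⁺; ∈-map⁻; ∈-concat⁺′; ∈-filter⁺; ∈-filter⁻; ∈-upTo⁺; ∈-upTo⁻)
open import Data.List.Membership.Propositional.Properties.WithK using (unique∧set⇒bag)
open import Data.List.Relation.Binary.BagAndSetEquality using (∼bag⇒↭)
open import Data.List.Relation.Binary.Permutation.Propositional using (_↭_; ↭⇒↭ₛ)
open import Data.List.Relation.Binary.Permutation.Setoid.Properties using (foldr-commMonoid)
open import Data.List.Relation.Unary.All using (All; []; _∷_; universal)
open import Data.List.Relation.Unary.All.Properties using () renaming (map⁺ to All-map⁺)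
open import Data.List.Relation.Unary.AllPairs using ([]; _∷_)
open import Data.List.Relation.Unary.Any as Any using (here; there; satisfied)
open import Data.List.Relation.Unary.Any.Properties using (lookup-index)
open import Data.List.Relation.Unary.Unique.Propositional.Properties
  using (filter⁺; upTo⁺) renaming (map⁺ to Unique-map⁺)
open import Data.Nat as ℕ using (zero; suc; _<_; s≤s; z≤n; z<s; NonZero)
import Data.Nat.Properties as ℕₚ
open import Data.Product using (Σ-syntax; _,_; proj₁; proj₂; ∃₂)
open import Data.Unit using (⊤; tt)
open import Data.Vec using (Vec; []; _∷_; replicate; zipWith; head; tail; init; last; initLast; _∷ʳ_; padRight)
open import Data.Vec.Properties
  using (∷-injectiveʳ; init-∷ʳ; last-∷ʳ; zipWith-assoc; zipWith-comm; zipWith-identityˡ; zipWith-identityʳ; padRight-refl)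
open import Function using (id; _∘_; flip; _⇔_; mk⇔; Equivalence)
open import Level using (0ℓ)
open import Relation.Binary.Definitions using (tri<; tri≈; tri>)
open import Relation.Binary.PropositionalEquality
  using (_≢_; refl; sym; trans; cong; cong₂; subst; setoid; isEquivalence; module ≡-Reasoning)
open import Relation.Nullary using (¬_; yes; no; _×-dec_)
open import Relation.Unary using (Pred; Decidable)

-- Powers and units in commutative monoids

2^[1+n]≡2+q : ∀ n → ∃[ q ] 2 ℕ.^ suc n ≡ suc (suc q)
2^[1+n]≡2+q n with ℕₚ.m≤n⇒∃[o]m+o≡n (ℕₚ.*-monoʳ-≤ 2 (ℕₚ.m^n>0 2 n))
... | q , 2+q≡2^[1+n] = q , sym 2+q≡2^[1+n]

∃-collision : ∀ {A : Set} (xs : List A) (g : ℕ → A) → (∀ i → g i ∈ xs) → ∃₂ λ i j → i < j × g i ≡ g j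
∃-collision xs g g∈xs with pigeonhole (ℕₚ.n<1+n (length xs)) (λ i → Any.index (g∈xs (toℕ i)))
... | i , j , i<j , same-index = toℕ i , toℕ j , i<j , (begin
  g (toℕ i)                             ≡⟨ lookup-index (g∈xs (toℕ i)) ⟩
  lookup xs (Any.index (g∈xs (toℕ i)))  ≡⟨ cong (lookup xs) same-index ⟩
  lookup xs (Any.index (g∈xs (toℕ j)))  ≡⟨ lookup-index (g∈xs (toℕ j)) ⟨
  g (toℕ j)                             ∎)
  where open ≡-Reasoning

module PowersAndUnits
  {A : Set} {mul : Op₂ A} {one : A}
  (isCommutativeMonoid : IsCommutativeMonoid _≡_ mul one) where

  commutativeMonoid : CommutativeMonoid 0ℓ 0ℓ
  commutativeMonoid = record { isCommutativeMonoid = isCommutativeMonoid }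

  open CommutativeMonoid commutativeMonoid
    using (_∙_; ε; assoc; comm; identityˡ; identityʳ; monoid; rawMonoid; rawMagma; commutativeSemigroup)
  open import Algebra.Definitions.RawMagma rawMagma public using (_∣_; _,_)
  open import Algebra.Definitions (_≡_ {A = A}) using (RightInvertible)
  open import Algebra.Definitions.RawMonoid rawMonoid using () renaming (_×_ to _×ᴹ_)
  open import Algebra.Properties.Monoid.Mult monoid using (×-homo-+; ×-assocˡ; ×-idem)
  open import Algebra.Properties.CommutativeMonoid.Mult commutativeMonoid using (×-distrib-+)
  open CommutativeSemigroupProperties commutativeSemigroup using (interchange)
  open ≡-Reasoning

  infixr 8 _^_
  _^_ : A → ℕ → A
  x ^ n = n ×ᴹ x

  ^-homo-∙ : ∀ x m n → x ^ (m ℕ.+ n) ≡ x ^ m ∙ x ^ n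
  ^-homo-∙ = ×-homo-+

  ^-assocʳ : ∀ x m n → (x ^ m) ^ n ≡ x ^ (n ℕ.* m)
  ^-assocʳ x m n = ×-assocˡ x n m

  ^-distrib-∙ : ∀ x y n → (x ∙ y) ^ n ≡ x ^ n ∙ y ^ n
  ^-distrib-∙ = ×-distrib-+

  idempotent⇒^≡ : ∀ {e} → e ∙ e ≡ e → ∀ n .{{_ : NonZero n}} → e ^ n ≡ e
  idempotent⇒^≡ = ×-idem

  periodic⇒idempotent : ∀ x q → x ^ suc (suc q) ≡ x → x ^ suc q ∙ x ^ suc q ≡ x ^ suc q
  periodic⇒idempotent x q periodic = begin
    x ^ suc q ∙ x ^ suc q       ≡⟨ ^-homo-∙ x (suc q) (suc q) ⟨
    x ^ (suc q ℕ.+ suc q)       ≡⟨ cong (λ n → x ^ suc n) (ℕₚ.+-suc q q) ⟩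
    x ^ (suc (suc q) ℕ.+ q)     ≡⟨ ^-homo-∙ x (suc (suc q)) q ⟩
    x ^ suc (suc q) ∙ x ^ q     ≡⟨ cong (_∙ x ^ q) periodic ⟩
    x ^ suc q                   ∎

  Unit : A → Set
  Unit = RightInvertible ε _∙_

  ∙-unit : ∀ {x y} → Unit x → Unit y → Unit (x ∙ y)
  ∙-unit {x} {y} (x⁻¹ , xx⁻¹≡ε) (y⁻¹ , yy⁻¹≡ε) = x⁻¹ ∙ y⁻¹ , (begin
    (x ∙ y) ∙ (x⁻¹ ∙ y⁻¹)  ≡⟨ interchange x y x⁻¹ y⁻¹ ⟩
    (x ∙ x⁻¹) ∙ (y ∙ y⁻¹)  ≡⟨ cong₂ _∙_ xx⁻¹≡ε yy⁻¹≡ε ⟩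
    ε ∙ ε                  ≡⟨ identityˡ ε ⟩
    ε                      ∎)

  ^-unit : ∀ {x} n → Unit x → Unit (x ^ n)
  ^-unit zero    _      = ε , identityˡ ε
  ^-unit (suc n) unit-x = ∙-unit unit-x (^-unit n unit-x)

  unit-cancelˡ : ∀ {u x y} → Unit u → u ∙ x ≡ u ∙ y → x ≡ y
  unit-cancelˡ {u} {x} {y} (u⁻¹ , uu⁻¹≡ε) ux≡uy = begin
    x              ≡⟨ identityˡ x ⟨
    ε ∙ x          ≡⟨ cong (_∙ x) u⁻¹u≡ε ⟨
    (u⁻¹ ∙ u) ∙ x  ≡⟨ assoc u⁻¹ u x ⟩
    u⁻¹ ∙ (u ∙ x)  ≡⟨ cong (u⁻¹ ∙_) ux≡uy ⟩
    u⁻¹ ∙ (u ∙ y)  ≡⟨ assoc u⁻¹ u y ⟨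
    (u⁻¹ ∙ u) ∙ y  ≡⟨ cong (_∙ y) u⁻¹u≡ε ⟩
    ε ∙ y          ≡⟨ identityˡ y ⟩
    y              ∎
    where
    u⁻¹u≡ε : u⁻¹ ∙ u ≡ ε
    u⁻¹u≡ε = trans (comm u⁻¹ u) uu⁻¹≡ε

  product : List A → A
  product = foldr _∙_ ε

  product-unit : ∀ xs → (∀ {x} → x ∈ xs → Unit x) → Unit (product xs)
  product-unit []       _     = ε , identityˡ ε
  product-unit (x ∷ xs) units = ∙-unit (units (here refl)) (product-unit xs (units ∘ there))

  product-map-∙ˡ : ∀ u xs → product (map (u ∙_) xs) ≡ u ^ length xs ∙ product xs
  product-map-∙ˡ u []       = sym (identityˡ ε)
  product-map-∙ˡ u (x ∷ xs) = begin
    (u ∙ x) ∙ product (map (u ∙_) xs)       ≡⟨ cong ((u ∙ x) ∙_) (product-map-∙ˡ u xs) ⟩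
    (u ∙ x) ∙ (u ^ length xs ∙ product xs)  ≡⟨ interchange u x (u ^ length xs) (product xs) ⟩
    u ^ suc (length xs) ∙ (x ∙ product xs)  ∎

  product-↭ : ∀ {xs ys} → xs ↭ ys → product xs ≡ product ys
  product-↭ xs↭ys = foldr-commMonoid (setoid A) isCommutativeMonoid (↭⇒↭ₛ xs↭ys)

  -- Euler's argument: multiplication by u permutes the units, so u^|U| ∏U = ∏U.
  unit^length≡ε : ∀ us → Unique us → (∀ {x} → x ∈ us → Unit x) → (∀ {x} → Unit x → x ∈ us) →
                  ∀ {u} → Unit u → u ^ length us ≡ ε
  unit^length≡ε us unique-us us⊆units units⊆us {u} unit-u@(u⁻¹ , uu⁻¹≡ε) =
    unit-cancelˡ (product-unit us us⊆units) (begin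
      product us ∙ u ^ length us  ≡⟨ comm (product us) (u ^ length us) ⟩
      u ^ length us ∙ product us  ≡⟨ product-map-∙ˡ u us ⟨
      product (map (u ∙_) us)     ≡⟨ product-↭ u·us↭us ⟩
      product us                  ≡⟨ identityʳ (product us) ⟨
      product us ∙ ε              ∎)
    where
    u·us⊆us : ∀ {x} → x ∈ map (u ∙_) us → x ∈ us
    u·us⊆us x∈u·us with ∈-map⁻ (u ∙_) x∈u·us
    ... | y , y∈us , refl = units⊆us (∙-unit unit-u (us⊆units y∈us))
    us⊆u·us : ∀ {x} → x ∈ us → x ∈ map (u ∙_) us
    us⊆u·us {x} x∈us = subst (_∈ map (u ∙_) us) u[u⁻¹x]≡x
      (∈-map⁺ (u ∙_) (units⊆us (∙-unit (u , trans (comm u⁻¹ u) uu⁻¹≡ε) (us⊆units x∈us))))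
      where
      u[u⁻¹x]≡x : u ∙ (u⁻¹ ∙ x) ≡ x
      u[u⁻¹x]≡x = trans (sym (assoc u u⁻¹ x)) (trans (cong (_∙ x) uu⁻¹≡ε) (identityˡ x))
    u·us↭us : map (u ∙_) us ↭ us
    u·us↭us = ∼bag⇒↭ (unique∧set⇒bag (Unique-map⁺ (unit-cancelˡ unit-u) unique-us) unique-us (mk⇔ u·us⊆us us⊆u·us))

  module Finite (elements : List A) (complete : ∀ x → x ∈ elements) where

    squares-eventually-periodic : ∀ x → ∃₂ λ a q → (x ^ 2 ℕ.^ a) ^ suc (suc q) ≡ x ^ 2 ℕ.^ a
    squares-eventually-periodic x with ∃-collision elements (λ i → x ^ 2 ℕ.^ i) (λ i → complete _)
    ... | a , b , a<b , x^2^a≡x^2^b with ℕₚ.m≤n⇒∃[o]m+o≡n a<b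
    ... | p , refl with 2^[1+n]≡2+q p
    ... | q , 2^[1+p]≡2+q = a , q , (begin
      (x ^ 2 ℕ.^ a) ^ suc (suc q)       ≡⟨ cong ((x ^ 2 ℕ.^ a) ^_) 2^[1+p]≡2+q ⟨
      (x ^ 2 ℕ.^ a) ^ 2 ℕ.^ suc p       ≡⟨ ^-assocʳ x (2 ℕ.^ a) (2 ℕ.^ suc p) ⟩
      x ^ (2 ℕ.^ suc p ℕ.* 2 ℕ.^ a)     ≡⟨ cong (x ^_) (ℕₚ.*-comm (2 ℕ.^ suc p) (2 ℕ.^ a)) ⟩
      x ^ (2 ℕ.^ a ℕ.* 2 ℕ.^ suc p)     ≡⟨ cong (x ^_) (ℕₚ.^-distribˡ-+-* 2 a (suc p)) ⟨
      x ^ 2 ℕ.^ (a ℕ.+ suc p)           ≡⟨ cong (λ n → x ^ 2 ℕ.^ n) (ℕₚ.+-suc a p) ⟩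
      x ^ 2 ℕ.^ suc (a ℕ.+ p)           ≡⟨ x^2^a≡x^2^b ⟨
      x ^ 2 ℕ.^ a                       ∎)

    ∃-idempotent-multiple : ∀ x → ∃₂ λ N e → e ∙ e ≡ e × x ^ N ∙ e ≡ x ^ N × x ∣ e
    ∃-idempotent-multiple x with squares-eventually-periodic x
    ... | a , q , periodic with ℕₚ.m≤n⇒∃[o]m+o≡n (ℕₚ.m^n>0 2 a)
    ... | t , 1+t≡2^a = 2 ℕ.^ a , T ^ suc q , periodic⇒idempotent T q periodic , periodic , x∣e
      where
      T = x ^ 2 ℕ.^ a
      x∣e : x ∣ T ^ suc q
      x∣e = x ^ t ∙ T ^ q , (begin
        (x ^ t ∙ T ^ q) ∙ x  ≡⟨ comm (x ^ t ∙ T ^ q) x ⟩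
        x ∙ (x ^ t ∙ T ^ q)  ≡⟨ assoc x (x ^ t) (T ^ q) ⟨
        x ^ suc t ∙ T ^ q    ≡⟨ cong (λ n → x ^ n ∙ T ^ q) 1+t≡2^a ⟩
        T ^ suc q            ∎)

-- Commutative rings of characteristic two

n<2^n : ∀ n → n < 2 ℕ.^ n
n<2^n zero    = z<s
n<2^n (suc n) = ℕₚ.+-mono-≤ (ℕₚ.m^n>0 2 n) (subst (suc n ≤_) (sym (ℕₚ.+-identityʳ _)) (n<2^n n))

-- Characteristic two is encoded by taking negation to be the identity.
module CharacteristicTwo
  {A : Set} {add mul : Op₂ A} {0ᴬ 1ᴬ : A}
  (isCommutativeRing : IsCommutativeRing _≡_ add mul id 0ᴬ 1ᴬ) where

  commutativeRing : CommutativeRing 0ℓ 0ℓ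
  commutativeRing = record { isCommutativeRing = isCommutativeRing }

  open CommutativeRing commutativeRing
    using (_+_; _*_; 0#; 1#; +-assoc; +-comm; +-identityˡ; +-identityʳ; -‿inverseʳ;
           *-assoc; *-comm; *-identityˡ; *-identityʳ; distribˡ; distribʳ; zeroˡ; zeroʳ;
           *-isCommutativeMonoid; *-commutativeSemigroup)
  open CommutativeSemigroupProperties *-commutativeSemigroup
    using () renaming (interchange to *-interchange; x∙yz≈y∙xz to x*yz≡y*xz)
  open PowersAndUnits *-isCommutativeMonoid public
  open ≡-Reasoning

  x+x≡0 : ∀ x → x + x ≡ 0#
  x+x≡0 = -‿inverseʳ

  x+y+y≡x : ∀ x y → x + y + y ≡ x
  x+y+y≡x x y = trans (+-assoc x y y) (trans (cong (x +_) (x+x≡0 y)) (+-identityʳ x))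

  x^2≡x*x : ∀ x → x ^ 2 ≡ x * x
  x^2≡x*x x = cong (x *_) (*-identityʳ x)

  [x+y]^2≡x^2+y^2 : ∀ x y → (x + y) ^ 2 ≡ x ^ 2 + y ^ 2
  [x+y]^2≡x^2+y^2 x y = begin
    (x + y) ^ 2                        ≡⟨ x^2≡x*x (x + y) ⟩
    (x + y) * (x + y)                  ≡⟨ distribʳ (x + y) x y ⟩
    x * (x + y) + y * (x + y)          ≡⟨ cong₂ _+_ (distribˡ x x y) (distribˡ y x y) ⟩
    (x * x + x * y) + (y * x + y * y)  ≡⟨ cong (λ z → (x * x + x * y) + (z + y * y)) (*-comm y x) ⟩
    (x * x + x * y) + (x * y + y * y)  ≡⟨ +-assoc (x * x) (x * y) (x * y + y * y) ⟩
    x * x + (x * y + (x * y + y * y))  ≡⟨ cong (x * x +_) (+-assoc (x * y) (x * y) (y * y)) ⟨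
    x * x + ((x * y + x * y) + y * y)  ≡⟨ cong (λ z → x * x + (z + y * y)) (x+x≡0 (x * y)) ⟩
    x * x + (0# + y * y)               ≡⟨ cong (x * x +_) (+-identityˡ (y * y)) ⟩
    x * x + y * y                      ≡⟨ cong₂ _+_ (x^2≡x*x x) (x^2≡x*x y) ⟨
    x ^ 2 + y ^ 2                      ∎

  frobenius : ∀ n x y → (x + y) ^ 2 ℕ.^ n ≡ x ^ 2 ℕ.^ n + y ^ 2 ℕ.^ n
  frobenius zero    x y = trans (*-identityʳ (x + y)) (sym (cong₂ _+_ (*-identityʳ x) (*-identityʳ y)))
  frobenius (suc n) x y = begin
    (x + y) ^ (2 ℕ.* 2 ℕ.^ n)                  ≡⟨ ^-assocʳ (x + y) (2 ℕ.^ n) 2 ⟨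
    ((x + y) ^ 2 ℕ.^ n) ^ 2                    ≡⟨ cong (_^ 2) (frobenius n x y) ⟩
    (x ^ 2 ℕ.^ n + y ^ 2 ℕ.^ n) ^ 2            ≡⟨ [x+y]^2≡x^2+y^2 (x ^ 2 ℕ.^ n) (y ^ 2 ℕ.^ n) ⟩
    (x ^ 2 ℕ.^ n) ^ 2 + (y ^ 2 ℕ.^ n) ^ 2      ≡⟨ cong₂ _+_ (^-assocʳ x (2 ℕ.^ n) 2) (^-assocʳ y (2 ℕ.^ n) 2) ⟩
    x ^ (2 ℕ.* 2 ℕ.^ n) + y ^ (2 ℕ.* 2 ℕ.^ n)  ∎

  1^n≡1 : ∀ n → 1# ^ n ≡ 1#
  1^n≡1 zero    = refl
  1^n≡1 (suc n) = trans (*-identityˡ (1# ^ n)) (1^n≡1 n)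

  ^≡0-mono : ∀ {x m n} → x ^ m ≡ 0# → m ≤ n → x ^ n ≡ 0#
  ^≡0-mono {x} {m} x^m≡0 m≤n with ℕₚ.m≤n⇒∃[o]m+o≡n m≤n
  ... | o , refl = trans (^-homo-∙ x m o) (trans (cong (_* x ^ o) x^m≡0) (zeroˡ (x ^ o)))

  ∣-nilpotent : ∀ {t y} n → t ∣ y → t ^ n ≡ 0# → y ^ n ≡ 0#
  ∣-nilpotent {t} {y} n (q , q*t≡y) t^n≡0 = begin
    y ^ n          ≡⟨ cong (_^ n) q*t≡y ⟨
    (q * t) ^ n    ≡⟨ ^-distrib-∙ q t n ⟩
    q ^ n * t ^ n  ≡⟨ cong (q ^ n *_) t^n≡0 ⟩
    q ^ n * 0#     ≡⟨ zeroʳ (q ^ n) ⟩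
    0#             ∎

  x^m*y^n≡0⇒[x*y]^[m+n]≡0 : ∀ {x y} m n → x ^ m * y ^ n ≡ 0# → (x * y) ^ (m ℕ.+ n) ≡ 0#
  x^m*y^n≡0⇒[x*y]^[m+n]≡0 {x} {y} m n x^m*y^n≡0 = begin
    (x * y) ^ (m ℕ.+ n)             ≡⟨ ^-distrib-∙ x y (m ℕ.+ n) ⟩
    x ^ (m ℕ.+ n) * y ^ (m ℕ.+ n)   ≡⟨ cong₂ _*_ (^-homo-∙ x m n) (trans (cong (y ^_) (ℕₚ.+-comm m n)) (^-homo-∙ y n m)) ⟩
    (x ^ m * x ^ n) * (y ^ n * y ^ m) ≡⟨ *-interchange (x ^ m) (x ^ n) (y ^ n) (y ^ m) ⟩
    (x ^ m * y ^ n) * (x ^ n * y ^ m) ≡⟨ cong (_* (x ^ n * y ^ m)) x^m*y^n≡0 ⟩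
    0# * (x ^ n * y ^ m)            ≡⟨ zeroˡ (x ^ n * y ^ m) ⟩
    0#                              ∎

  unit⇒¬nilpotent : 1# ≢ 0# → ∀ {x} n → Unit x → x ^ n ≢ 0#
  unit⇒¬nilpotent 1≢0 n unit-x x^n≡0 with ^-unit n unit-x
  ... | y , x^n*y≡1 = 1≢0 (trans (sym x^n*y≡1) (trans (cong (_* y) x^n≡0) (zeroˡ y)))

  x+1-nilpotent⇒unit : ∀ x n → (x + 1#) ^ n ≡ 0# → Unit x
  x+1-nilpotent⇒unit x n [x+1]^n≡0 with ℕₚ.m≤n⇒∃[o]m+o≡n (ℕₚ.m^n>0 2 n)
  ... | t , 1+t≡2^n = x ^ t , (begin
    x * x ^ t                          ≡⟨ cong (x ^_) 1+t≡2^n ⟩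
    x ^ 2 ℕ.^ n                        ≡⟨ cong (_^ 2 ℕ.^ n) (x+y+y≡x x 1#) ⟨
    (x + 1# + 1#) ^ 2 ℕ.^ n            ≡⟨ frobenius n (x + 1#) 1# ⟩
    (x + 1#) ^ 2 ℕ.^ n + 1# ^ 2 ℕ.^ n  ≡⟨ cong₂ _+_ (^≡0-mono [x+1]^n≡0 (ℕₚ.<⇒≤ (n<2^n n))) (1^n≡1 (2 ℕ.^ n)) ⟩
    0# + 1#                            ≡⟨ +-identityˡ 1# ⟩
    1#                                 ∎)

  module Idempotent {e : A} (e*e≡e : e * e ≡ e) where

    [1+e]*e≡0 : (1# + e) * e ≡ 0#
    [1+e]*e≡0 = trans (distribʳ e 1# e) (trans (cong₂ _+_ (*-identityˡ e) e*e≡e) (x+x≡0 e))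

    [1+e]*[1+e]≡1+e : (1# + e) * (1# + e) ≡ 1# + e
    [1+e]*[1+e]≡1+e = begin
      (1# + e) * (1# + e)           ≡⟨ distribˡ (1# + e) 1# e ⟩
      (1# + e) * 1# + (1# + e) * e  ≡⟨ cong₂ _+_ (*-identityʳ (1# + e)) [1+e]*e≡0 ⟩
      (1# + e) + 0#                 ≡⟨ +-identityʳ (1# + e) ⟩
      1# + e                        ∎

    [1+e]*[e*x]≡0 : ∀ x → (1# + e) * (e * x) ≡ 0#
    [1+e]*[e*x]≡0 x = trans (sym (*-assoc (1# + e) e x)) (trans (cong (_* x) [1+e]*e≡0) (zeroˡ x))

    1+e+e*x-unit : ∀ {x y} → x * y ≡ e → Unit (1# + e + e * x)
    1+e+e*x-unit {x} {y} x*y≡e = a + e * y , (begin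
      (a + e * x) * (a + e * y)
        ≡⟨ distribʳ (a + e * y) a (e * x) ⟩
      a * (a + e * y) + e * x * (a + e * y)
        ≡⟨ cong₂ _+_ (distribˡ a a (e * y)) (distribˡ (e * x) a (e * y)) ⟩
      (a * a + a * (e * y)) + (e * x * a + e * x * (e * y))  ≡⟨ cong₂ (λ p q → (a * a + p) + (q + e * x * (e * y)))
                                                                      ([1+e]*[e*x]≡0 y) (trans (*-comm (e * x) a) ([1+e]*[e*x]≡0 x)) ⟩
      (a * a + 0#) + (0# + e * x * (e * y))
        ≡⟨ cong₂ _+_ (+-identityʳ (a * a)) (+-identityˡ (e * x * (e * y))) ⟩
      a * a + e * x * (e * y)
        ≡⟨ cong₂ _+_ [1+e]*[1+e]≡1+e ex*ey≡e ⟩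
      1# + e + e
        ≡⟨ x+y+y≡x 1# e ⟩
      1# ∎)
      where
      a = 1# + e
      ex*ey≡e : e * x * (e * y) ≡ e
      ex*ey≡e = trans (*-interchange e x e y) (trans (cong₂ _*_ e*e≡e x*y≡e) e*e≡e)

    1+e+e*x+1≡e*[x+1] : ∀ x → 1# + e + e * x + 1# ≡ e * (x + 1#)
    1+e+e*x+1≡e*[x+1] x = begin
      1# + e + e * x + 1#      ≡⟨ +-comm (1# + e + e * x) 1# ⟩
      1# + (1# + e + e * x)    ≡⟨ cong (1# +_) (+-assoc 1# e (e * x)) ⟩
      1# + (1# + (e + e * x))  ≡⟨ +-assoc 1# 1# (e + e * x) ⟨
      (1# + 1#) + (e + e * x)  ≡⟨ cong (_+ (e + e * x)) (x+x≡0 1#) ⟩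
      0# + (e + e * x)         ≡⟨ +-identityˡ (e + e * x) ⟩
      e + e * x                ≡⟨ +-comm e (e * x) ⟩
      e * x + e                ≡⟨ cong (e * x +_) (*-identityʳ e) ⟨
      e * x + e * 1#           ≡⟨ distribˡ e x 1# ⟨
      e * (x + 1#)             ∎

  module _ {m : ℕ} (unipotent : ∀ {u} → Unit u → u ^ 2 ℕ.^ m ≡ 1#) where

    -- u = 1 + e + e x is a unit with u + 1 = e (x + 1), so e (x + 1)^N = (u + 1)^N = u^N + 1 = 0;
    -- as x + 1 divides e, also e = e · e^N = 0.
    idempotent-multiple-of-x[x+1]≡0 : ∀ {x e} → e * e ≡ e → x * (x + 1#) ∣ e → e ≡ 0#
    idempotent-multiple-of-x[x+1]≡0 {x} {e} e*e≡e (y , y*x[x+1]≡e) = begin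
      e                                  ≡⟨ e*e≡e ⟨
      e * e                              ≡⟨ cong (e *_) e^N≡e ⟨
      e * e ^ N                          ≡⟨ cong (λ z → e * z ^ N) e≡[x+1]*[y*x] ⟩
      e * ((x + 1#) * (y * x)) ^ N       ≡⟨ cong (e *_) (^-distrib-∙ (x + 1#) (y * x) N) ⟩
      e * ((x + 1#) ^ N * (y * x) ^ N)   ≡⟨ *-assoc e ((x + 1#) ^ N) ((y * x) ^ N) ⟨
      e * (x + 1#) ^ N * (y * x) ^ N     ≡⟨ cong (_* (y * x) ^ N) e*[x+1]^N≡0 ⟩
      0# * (y * x) ^ N                   ≡⟨ zeroˡ ((y * x) ^ N) ⟩
      0#                                 ∎
      where
      open Idempotent e*e≡e
      N = 2 ℕ.^ m
      u = 1# + e + e * x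
      e^N≡e : e ^ N ≡ e
      e^N≡e = idempotent⇒^≡ e*e≡e N {{ℕₚ.m^n≢0 2 m}}
      e≡[x+1]*[y*x] : e ≡ (x + 1#) * (y * x)
      e≡[x+1]*[y*x] = sym (trans (x*yz≡y*xz (x + 1#) y x) (trans (cong (y *_) (*-comm (x + 1#) x)) y*x[x+1]≡e))
      x*[y*[x+1]]≡e : x * (y * (x + 1#)) ≡ e
      x*[y*[x+1]]≡e = trans (x*yz≡y*xz x y (x + 1#)) y*x[x+1]≡e
      e*[x+1]^N≡0 : e * (x + 1#) ^ N ≡ 0#
      e*[x+1]^N≡0 = begin
        e * (x + 1#) ^ N      ≡⟨ cong (_* (x + 1#) ^ N) e^N≡e ⟨
        e ^ N * (x + 1#) ^ N  ≡⟨ ^-distrib-∙ e (x + 1#) N ⟨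
        (e * (x + 1#)) ^ N    ≡⟨ cong (_^ N) (1+e+e*x+1≡e*[x+1] x) ⟨
        (u + 1#) ^ N          ≡⟨ frobenius m u 1# ⟩
        u ^ N + 1# ^ N        ≡⟨ cong₂ _+_ (unipotent (1+e+e*x-unit x*[y*[x+1]]≡e)) (1^n≡1 N) ⟩
        1# + 1#               ≡⟨ x+x≡0 1# ⟩
        0#                    ∎

    module _ (elements : List A) (complete : ∀ x → x ∈ elements) where
      open Finite elements complete

      x[x+1]-nilpotent : ∀ x → ∃[ N ] (x * (x + 1#)) ^ N ≡ 0#
      x[x+1]-nilpotent x = nilpotent (∃-idempotent-multiple s)
        where
        s : A
        s = x * (x + 1#)
        nilpotent : (∃₂ λ N e → e * e ≡ e × s ^ N * e ≡ s ^ N × s ∣ e) → ∃[ N ] s ^ N ≡ 0#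
        nilpotent (N , e , e*e≡e , s^N*e≡s^N , s∣e) = N , (begin
          s ^ N       ≡⟨ s^N*e≡s^N ⟨
          s ^ N * e   ≡⟨ cong (s ^ N *_) (idempotent-multiple-of-x[x+1]≡0 e*e≡e s∣e) ⟩
          s ^ N * 0#  ≡⟨ zeroʳ (s ^ N) ⟩
          0#          ∎)

-- Vectors over F₂

module _ {A : Set} where

  replicate-∷ʳ : ∀ n (a : A) → replicate n a ∷ʳ a ≡ replicate (suc n) a
  replicate-∷ʳ zero    a = refl
  replicate-∷ʳ (suc n) a = cong (a ∷_) (replicate-∷ʳ n a)

  padRight-∷ʳ : ∀ {m n} (m≤n : m ≤ n) a (xs : Vec A m) →
                padRight (ℕₚ.m≤n⇒m≤1+n m≤n) a xs ≡ padRight m≤n a xs ∷ʳ a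
  padRight-∷ʳ {n = n} z≤n a []       = sym (replicate-∷ʳ n a)
  padRight-∷ʳ (s≤s m≤n)   a (x ∷ xs) = cong (x ∷_) (padRight-∷ʳ m≤n a xs)

  init∷ʳlast : ∀ {n} (xs : Vec A (suc n)) → init xs ∷ʳ last xs ≡ xs
  init∷ʳlast xs = sym (proj₂ (proj₂ (initLast xs)))

infixl 6 _⊕_
_⊕_ : ∀ {n} → Vec Bool n → Vec Bool n → Vec Bool n
_⊕_ = zipWith _xor_

0ᵛ : ∀ {n} → Vec Bool n
0ᵛ = replicate _ false

infixr 7 _·_
_·_ : ∀ {n} → Bool → Vec Bool n → Vec Bool n
b · v = if b then v else 0ᵛ

⊕-assoc : ∀ {n} (u v w : Vec Bool n) → u ⊕ v ⊕ w ≡ u ⊕ (v ⊕ w)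
⊕-assoc = zipWith-assoc xor-assoc

⊕-comm : ∀ {n} (u v : Vec Bool n) → u ⊕ v ≡ v ⊕ u
⊕-comm = zipWith-comm xor-comm

⊕-identityˡ : ∀ {n} (v : Vec Bool n) → 0ᵛ ⊕ v ≡ v
⊕-identityˡ = zipWith-identityˡ xor-identityˡ

⊕-identityʳ : ∀ {n} (v : Vec Bool n) → v ⊕ 0ᵛ ≡ v
⊕-identityʳ = zipWith-identityʳ xor-identityʳ

v⊕v≡0 : ∀ {n} (v : Vec Bool n) → v ⊕ v ≡ 0ᵛ
v⊕v≡0 []      = refl
v⊕v≡0 (b ∷ v) = cong₂ _∷_ (xor-same b) (v⊕v≡0 v)

⊕-isAbelianGroup : ∀ {n} → IsAbelianGroup _≡_ (_⊕_ {n}) 0ᵛ id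
⊕-isAbelianGroup = record
  { isGroup = record
    { isMonoid = record
      { isSemigroup = record
        { isMagma = record { isEquivalence = isEquivalence ; ∙-cong = cong₂ _⊕_ }
        ; assoc   = ⊕-assoc
        }
      ; identity = ⊕-identityˡ , ⊕-identityʳ
      }
    ; inverse = v⊕v≡0 , v⊕v≡0
    ; ⁻¹-cong = id
    }
  ; comm = ⊕-comm
  }

⊕-abelianGroup : ℕ → AbelianGroup 0ℓ 0ℓ
⊕-abelianGroup n = record { isAbelianGroup = ⊕-isAbelianGroup {n} }

⊕≡0⇒≡ : ∀ {n} {u v : Vec Bool n} → u ⊕ v ≡ 0ᵛ → u ≡ v
⊕≡0⇒≡ {n} {u} {v} = inverseˡ-unique u v
  where open GroupProperties (AbelianGroup.group (⊕-abelianGroup n))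

⊕-interchange : ∀ {n} (u v w x : Vec Bool n) → (u ⊕ v) ⊕ (w ⊕ x) ≡ (u ⊕ w) ⊕ (v ⊕ x)
⊕-interchange {n} = interchange
  where open CommutativeSemigroupProperties (AbelianGroup.commutativeSemigroup (⊕-abelianGroup n))

·-distribʳ-xor : ∀ {n} a b (v : Vec Bool n) → (a xor b) · v ≡ a · v ⊕ b · v
·-distribʳ-xor false b     v = sym (⊕-identityˡ (b · v))
·-distribʳ-xor true  false v = sym (⊕-identityʳ v)
·-distribʳ-xor true  true  v = sym (v⊕v≡0 v)

·-distribˡ-⊕ : ∀ {n} a (u v : Vec Bool n) → a · (u ⊕ v) ≡ a · u ⊕ a · v
·-distribˡ-⊕ false u v = sym (v⊕v≡0 0ᵛ)
·-distribˡ-⊕ true  u v = refl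

init-⊕ : ∀ {n} (u v : Vec Bool (suc n)) → init (u ⊕ v) ≡ init u ⊕ init v
init-⊕ {zero}  (a ∷ []) (b ∷ []) = refl
init-⊕ {suc n} (a ∷ u)  (b ∷ v)  = cong ((a xor b) ∷_) (init-⊕ u v)

last-⊕ : ∀ {n} (u v : Vec Bool (suc n)) → last (u ⊕ v) ≡ last u xor last v
last-⊕ {zero}  (a ∷ []) (b ∷ []) = refl
last-⊕ {suc n} (a ∷ u)  (b ∷ v)  = last-⊕ u v

∷ʳ-⊕ : ∀ {n} (u v : Vec Bool n) a b → (u ∷ʳ a) ⊕ (v ∷ʳ b) ≡ (u ⊕ v) ∷ʳ (a xor b)
∷ʳ-⊕ []      []      a b = refl
∷ʳ-⊕ (x ∷ u) (y ∷ v) a b = cong ((x xor y) ∷_) (∷ʳ-⊕ u v a b)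

head-⊕ : ∀ {n} (u v : Vec Bool (suc n)) → head (u ⊕ v) ≡ head u xor head v
head-⊕ (a ∷ u) (b ∷ v) = refl

head-· : ∀ {n} a (v : Vec Bool (suc n)) → head (a · v) ≡ a ∧ head v
head-· false v = refl
head-· true  v = refl

parity : ∀ {n} → Vec Bool n → Bool
parity []      = false
parity (b ∷ v) = b xor parity v

parity-⊕ : ∀ {n} (u v : Vec Bool n) → parity (u ⊕ v) ≡ parity u xor parity v
parity-⊕ []      []      = refl
parity-⊕ (a ∷ u) (b ∷ v) = trans (cong ((a xor b) xor_) (parity-⊕ u v)) (xor-interchange a b (parity u) (parity v))
  where
  open CommutativeSemigroupProperties (CommutativeRing.+-commutativeSemigroup xor-∧-commutativeRing)
    using () renaming (interchange to xor-interchange)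

parity-∷ʳ : ∀ {n} (v : Vec Bool n) b → parity (v ∷ʳ b) ≡ parity v xor b
parity-∷ʳ []      b = xor-identityʳ b
parity-∷ʳ (a ∷ v) b = trans (cong (a xor_) (parity-∷ʳ v b)) (sym (xor-assoc a (parity v) b))

parity-0 : ∀ n → parity (0ᵛ {n}) ≡ false
parity-0 zero    = refl
parity-0 (suc n) = parity-0 n

parity-· : ∀ {n} a (v : Vec Bool n) → parity (a · v) ≡ a ∧ parity v
parity-· {n} false v = parity-0 n
parity-·     true  v = refl

xor-cancelˡ : ∀ a b → a xor (a xor b) ≡ b
xor-cancelˡ a b = trans (sym (xor-assoc a a b)) (cong (_xor b) (xor-same a))

xor≡⇔≡xor : ∀ b q p → b xor q ≡ p ⇔ b ≡ p xor q
xor≡⇔≡xor b q p = mk⇔ (λ b+q≡p → trans (sym (x+y+y≡x b q)) (cong (_xor q) b+q≡p))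
                      (λ b≡p+q → trans (cong (_xor q) b≡p+q) (x+y+y≡x p q))
  where
  x+y+y≡x : ∀ x y → (x xor y) xor y ≡ x
  x+y+y≡x x y = trans (xor-assoc x y y) (trans (cong (x xor_) (xor-same y)) (xor-identityʳ x))

-- Vectors list coefficients lowest degree first, so this reads v = (x + 1) q + b + e xⁿ.
divide-by-x+1 : ∀ {n} (v : Vec Bool (suc n)) b e → parity v ≡ b xor e → ∃[ q ] v ≡ (b ∷ q) ⊕ (q ∷ʳ e)
divide-by-x+1 {zero}  (a ∷ []) b e parity≡ = [] , cong (_∷ []) (trans (sym (xor-identityʳ a)) parity≡)
divide-by-x+1 {suc n} (a ∷ v)  b e parity≡ with divide-by-x+1 v (a xor b) e parity-v≡
  where
  parity-v≡ : parity v ≡ (a xor b) xor e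
  parity-v≡ = trans (sym (xor-cancelˡ a (parity v))) (trans (cong (a xor_) parity≡) (sym (xor-assoc a b e)))
... | q , v≡ = (a xor b) ∷ q , cong₂ _∷_ (sym (trans (cong (b xor_) (xor-comm a b)) (xor-cancelˡ b a))) v≡

branch : ∀ {n} → Vec Bool n → List (Vec Bool (suc n))
branch v = (false ∷ v) ∷ (true ∷ v) ∷ []

∈-allVecs : ∀ {n} (v : Vec Bool n) → v ∈ allVecs n
∈-allVecs []      = here refl
∈-allVecs (b ∷ v) = ∈-concat⁺′ (b∷v∈branch b) (∈-map⁺ branch (∈-allVecs v))
  where
  b∷v∈branch : ∀ b → (b ∷ v) ∈ branch v
  b∷v∈branch false = here refl
  b∷v∈branch true  = there (here refl)

allVecs-unique : ∀ n → Unique (allVecs n)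
allVecs-unique zero    = [] ∷ []
allVecs-unique (suc n) = concatMap-branch-unique (allVecs-unique n)
  where
  fresh : ∀ {v vs} b → All (v ≢_) vs → All ((b ∷ v) ≢_) (concatMap branch vs)
  fresh b []           = []
  fresh b (v≢w ∷ v∉vs) = (v≢w ∘ ∷-injectiveʳ) ∷ (v≢w ∘ ∷-injectiveʳ) ∷ fresh b v∉vs
  concatMap-branch-unique : ∀ {vs : List (Vec Bool n)} → Unique vs → Unique (concatMap branch vs)
  concatMap-branch-unique []              = []
  concatMap-branch-unique (v∉vs ∷ unique) = ((λ ()) ∷ fresh false v∉vs) ∷ fresh true v∉vs ∷ concatMap-branch-unique unique

length-allVecs : ∀ n → length (allVecs n) ≡ 2 ℕ.^ n
length-allVecs zero    = refl
length-allVecs (suc n) = trans (length-concatMap-branch (allVecs n)) (cong (2 ℕ.*_) (length-allVecs n))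
  where
  length-concatMap-branch : (vs : List (Vec Bool n)) → length (concatMap branch vs) ≡ 2 ℕ.* length vs
  length-concatMap-branch []       = refl
  length-concatMap-branch (v ∷ vs) = trans (cong (suc ∘ suc) (length-concatMap-branch vs)) (sym (ℕₚ.*-suc 2 (length vs)))

module _ {n} {P : Pred (Vec Bool (suc n)) 0ℓ} {Q : Pred (Vec Bool n) 0ℓ} (P? : Decidable P) (Q? : Decidable Q)
         (g : Vec Bool n → Bool) (P⇔ : ∀ b v → P (b ∷ v) ⇔ (b ≡ g v × Q v)) where

  open ≡-Reasoning

  private
    to : ∀ b {v} → P (b ∷ v) → b ≡ g v × Q v
    to b {v} = Equivalence.to (P⇔ b v)
    from : ∀ b {v} → b ≡ g v × Q v → P (b ∷ v)
    from b {v} = Equivalence.from (P⇔ b v)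
    true≢false : true ≢ false
    true≢false ()

  length-filter-allVecs : length (filter P? (allVecs (suc n))) ≡ length (filter Q? (allVecs n))
  length-filter-allVecs = go (allVecs n)
    where
    go : ∀ vs → length (filter P? (concatMap branch vs)) ≡ length (filter Q? vs)
    go []       = refl
    go (v ∷ vs) with Q? v | g v in g-v≡
    ... | no ¬q | _ = begin
      length (filter P? ((false ∷ v) ∷ (true ∷ v) ∷ concatMap branch vs))
        ≡⟨ cong length (filter-reject P? (¬q ∘ proj₂ ∘ to false)) ⟩
      length (filter P? ((true ∷ v) ∷ concatMap branch vs))
        ≡⟨ cong length (filter-reject P? (¬q ∘ proj₂ ∘ to true)) ⟩
      length (filter P? (concatMap branch vs))
        ≡⟨ go vs ⟩
      length (filter Q? vs) ∎
    ... | yes q | false = begin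
      length (filter P? ((false ∷ v) ∷ (true ∷ v) ∷ concatMap branch vs))
        ≡⟨ cong length (filter-accept P? (from false (sym g-v≡ , q))) ⟩
      suc (length (filter P? ((true ∷ v) ∷ concatMap branch vs)))
        ≡⟨ cong (suc ∘ length) (filter-reject P? (true≢false ∘ flip trans g-v≡ ∘ proj₁ ∘ to true)) ⟩
      suc (length (filter P? (concatMap branch vs)))
        ≡⟨ cong suc (go vs) ⟩
      suc (length (filter Q? vs)) ∎
    ... | yes q | true = begin
      length (filter P? ((false ∷ v) ∷ (true ∷ v) ∷ concatMap branch vs))
        ≡⟨ cong length (filter-reject P? (true≢false ∘ sym ∘ flip trans g-v≡ ∘ proj₁ ∘ to false)) ⟩
      length (filter P? ((true ∷ v) ∷ concatMap branch vs))
        ≡⟨ cong length (filter-accept P? (from true (sym g-v≡ , q))) ⟩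
      suc (length (filter P? (concatMap branch vs)))
        ≡⟨ cong suc (go vs) ⟩
      suc (length (filter Q? vs)) ∎

⊤? : ∀ {n} → Decidable {A = Vec Bool n} (λ _ → ⊤)
⊤? _ = yes tt

length-filter-⊤-allVecs : ∀ n → length (filter ⊤? (allVecs n)) ≡ 2 ℕ.^ n
length-filter-⊤-allVecs n = trans (cong length (filter-all ⊤? (universal _ (allVecs n)))) (length-allVecs n)

length-filter-head≡true : ∀ n → length (filter (λ v → head v ≟ᵇ true) (allVecs (suc n))) ≡ 2 ℕ.^ n
length-filter-head≡true n =
  trans (length-filter-allVecs {n} (λ v → head v ≟ᵇ true) ⊤? (λ _ → true) (λ b v → mk⇔ (_, tt) proj₁))
        (length-filter-⊤-allVecs n)

length-filter-parity≡ : ∀ n p → length (filter (λ v → parity v ≟ᵇ p) (allVecs (suc n))) ≡ 2 ℕ.^ n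
length-filter-parity≡ n p =
  trans (length-filter-allVecs {n} (λ v → parity v ≟ᵇ p) ⊤? (λ v → p xor parity v) P⇔) (length-filter-⊤-allVecs n)
  where
  P⇔ : ∀ b v → b xor parity v ≡ p ⇔ (b ≡ p xor parity v × ⊤)
  P⇔ b v = mk⇔ ((_, tt) ∘ Equivalence.to (xor≡⇔≡xor b (parity v) p))
               (Equivalence.from (xor≡⇔≡xor b (parity v) p) ∘ proj₁)

length-filter-head∧parity≡true :
  ∀ n → length (filter (λ v → (head v ≟ᵇ true) ×-dec (parity v ≟ᵇ true)) (allVecs (suc (suc n)))) ≡ 2 ℕ.^ n
length-filter-head∧parity≡true n =
  trans (length-filter-allVecs {suc n} (λ v → (head v ≟ᵇ true) ×-dec (parity v ≟ᵇ true)) (λ v → parity v ≟ᵇ false)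
          (λ _ → true) (λ b v → mk⇔ (to b v) (from b v)))
        (length-filter-parity≡ n false)
  where
  to : ∀ b v → b ≡ true × b xor parity v ≡ true → b ≡ true × parity v ≡ false
  to true v (refl , 1+p≡1) = refl , trans (sym (not-involutive (parity v))) (cong not 1+p≡1)
  from : ∀ b v → b ≡ true × parity v ≡ false → b ≡ true × b xor parity v ≡ true
  from true v (refl , p≡0) = refl , cong not p≡0

-- The quotient ring A/fA

mulX-def : ∀ {k} (c : Vec Bool (suc k)) v → Quot.mulX c v ≡ (false ∷ init v) ⊕ last v · c
mulX-def c v with last v
... | true  = refl
... | false = sym (⊕-identityʳ (false ∷ init v))

module QuotientRing {k : ℕ} (c : Vec Bool (suc k)) where

  open Quot c public
  open ≡-Reasoning

  d : ℕ
  d = suc k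

  mulX-⊕ : ∀ u v → mulX (u ⊕ v) ≡ mulX u ⊕ mulX v
  mulX-⊕ u v = begin
    mulX (u ⊕ v)
      ≡⟨ mulX-def c (u ⊕ v) ⟩
    (false ∷ init (u ⊕ v)) ⊕ last (u ⊕ v) · c
      ≡⟨ cong₂ (λ i l → (false ∷ i) ⊕ l · c) (init-⊕ u v) (last-⊕ u v) ⟩
    ((false ∷ init u) ⊕ (false ∷ init v)) ⊕ (last u xor last v) · c
      ≡⟨ cong (((false ∷ init u) ⊕ (false ∷ init v)) ⊕_) (·-distribʳ-xor (last u) (last v) c) ⟩
    ((false ∷ init u) ⊕ (false ∷ init v)) ⊕ (last u · c ⊕ last v · c)
      ≡⟨ ⊕-interchange _ _ _ _ ⟩
    ((false ∷ init u) ⊕ last u · c) ⊕ ((false ∷ init v) ⊕ last v · c)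
      ≡⟨ cong₂ _⊕_ (mulX-def c u) (mulX-def c v) ⟨
    mulX u ⊕ mulX v ∎

  mulX-0 : mulX 0ᵛ ≡ 0ᵛ
  mulX-0 = trans (cong mulX (sym (v⊕v≡0 0ᵛ))) (trans (mulX-⊕ 0ᵛ 0ᵛ) (v⊕v≡0 (mulX 0ᵛ)))

  mulX-· : ∀ b v → mulX (b · v) ≡ b · mulX v
  mulX-· false v = mulX-0
  mulX-· true  v = refl

  mulX-∷ʳ : ∀ (w : Vec Bool k) b → mulX (w ∷ʳ b) ≡ (false ∷ w) ⊕ b · c
  mulX-∷ʳ w b = trans (mulX-def c (w ∷ʳ b)) (cong₂ (λ i l → (false ∷ i) ⊕ l · c) (init-∷ʳ b w) (last-∷ʳ b w))

  mulX^ : ℕ → Res → Res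
  mulX^ zero    v = v
  mulX^ (suc n) v = mulX (mulX^ n v)

  mulPoly-0ʳ : ∀ {m} (p : Vec Bool m) → mulPoly p 0ᵛ ≡ 0ᵛ
  mulPoly-0ʳ []      = refl
  mulPoly-0ʳ (a ∷ p) = begin
    a · 0ᵛ ⊕ mulX (mulPoly p 0ᵛ)  ≡⟨ cong₂ (λ x y → x ⊕ mulX y) (a·0≡0 a) (mulPoly-0ʳ p) ⟩
    0ᵛ ⊕ mulX 0ᵛ                  ≡⟨ ⊕-identityˡ (mulX 0ᵛ) ⟩
    mulX 0ᵛ                       ≡⟨ mulX-0 ⟩
    0ᵛ                            ∎
    where
    a·0≡0 : ∀ a → a · 0ᵛ ≡ 0ᵛ {d}
    a·0≡0 false = refl
    a·0≡0 true  = refl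

  mulPoly-0ˡ : ∀ m v → mulPoly (0ᵛ {m}) v ≡ 0ᵛ
  mulPoly-0ˡ zero    v = refl
  mulPoly-0ˡ (suc m) v = trans (⊕-identityˡ _) (trans (cong mulX (mulPoly-0ˡ m v)) mulX-0)

  mulPoly-1 : ∀ m v → mulPoly (true ∷ 0ᵛ {m}) v ≡ v
  mulPoly-1 m v = trans (cong (λ z → v ⊕ mulX z) (mulPoly-0ˡ m v)) (trans (cong (v ⊕_) mulX-0) (⊕-identityʳ v))

  mulPoly-⊕ʳ : ∀ {m} (p : Vec Bool m) u v → mulPoly p (u ⊕ v) ≡ mulPoly p u ⊕ mulPoly p v
  mulPoly-⊕ʳ []      u v = sym (v⊕v≡0 0ᵛ)
  mulPoly-⊕ʳ (a ∷ p) u v = begin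
    a · (u ⊕ v) ⊕ mulX (mulPoly p (u ⊕ v))
      ≡⟨ cong₂ (λ x y → x ⊕ mulX y) (·-distribˡ-⊕ a u v) (mulPoly-⊕ʳ p u v) ⟩
    (a · u ⊕ a · v) ⊕ mulX (mulPoly p u ⊕ mulPoly p v)
      ≡⟨ cong ((a · u ⊕ a · v) ⊕_) (mulX-⊕ _ _) ⟩
    (a · u ⊕ a · v) ⊕ (mulX (mulPoly p u) ⊕ mulX (mulPoly p v))
      ≡⟨ ⊕-interchange _ _ _ _ ⟩
    (a · u ⊕ mulX (mulPoly p u)) ⊕ (a · v ⊕ mulX (mulPoly p v)) ∎

  mulPoly-⊕ˡ : ∀ {m} (p q : Vec Bool m) v → mulPoly (p ⊕ q) v ≡ mulPoly p v ⊕ mulPoly q v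
  mulPoly-⊕ˡ []      []      v = sym (v⊕v≡0 0ᵛ)
  mulPoly-⊕ˡ (a ∷ p) (b ∷ q) v = begin
    (a xor b) · v ⊕ mulX (mulPoly (p ⊕ q) v)
      ≡⟨ cong₂ (λ x y → x ⊕ mulX y) (·-distribʳ-xor a b v) (mulPoly-⊕ˡ p q v) ⟩
    (a · v ⊕ b · v) ⊕ mulX (mulPoly p v ⊕ mulPoly q v)
      ≡⟨ cong ((a · v ⊕ b · v) ⊕_) (mulX-⊕ _ _) ⟩
    (a · v ⊕ b · v) ⊕ (mulX (mulPoly p v) ⊕ mulX (mulPoly q v))
      ≡⟨ ⊕-interchange _ _ _ _ ⟩
    (a · v ⊕ mulX (mulPoly p v)) ⊕ (b · v ⊕ mulX (mulPoly q v)) ∎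

  mulPoly-·ʳ : ∀ {m} (p : Vec Bool m) b v → mulPoly p (b · v) ≡ b · mulPoly p v
  mulPoly-·ʳ p false v = mulPoly-0ʳ p
  mulPoly-·ʳ p true  v = refl

  mulPoly-·ˡ : ∀ {m} b (p : Vec Bool m) v → mulPoly (b · p) v ≡ b · mulPoly p v
  mulPoly-·ˡ {m} false p v = mulPoly-0ˡ m v
  mulPoly-·ˡ     true  p v = refl

  mulPoly-mulXʳ : ∀ {m} (p : Vec Bool m) v → mulPoly p (mulX v) ≡ mulX (mulPoly p v)
  mulPoly-mulXʳ []      v = sym mulX-0
  mulPoly-mulXʳ (a ∷ p) v = begin
    a · mulX v ⊕ mulX (mulPoly p (mulX v))    ≡⟨ cong (λ y → a · mulX v ⊕ mulX y) (mulPoly-mulXʳ p v) ⟩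
    a · mulX v ⊕ mulX (mulX (mulPoly p v))    ≡⟨ cong (_⊕ mulX (mulX (mulPoly p v))) (mulX-· a v) ⟨
    mulX (a · v) ⊕ mulX (mulX (mulPoly p v))  ≡⟨ mulX-⊕ _ _ ⟨
    mulX (a · v ⊕ mulX (mulPoly p v))         ∎

  mulPoly-mulX^ʳ : ∀ {m} (p : Vec Bool m) n v → mulPoly p (mulX^ n v) ≡ mulX^ n (mulPoly p v)
  mulPoly-mulX^ʳ p zero    v = refl
  mulPoly-mulX^ʳ p (suc n) v = trans (mulPoly-mulXʳ p (mulX^ n v)) (cong mulX (mulPoly-mulX^ʳ p n v))

  mulPoly-comm : ∀ {m n} (p : Vec Bool m) (q : Vec Bool n) v → mulPoly p (mulPoly q v) ≡ mulPoly q (mulPoly p v)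
  mulPoly-comm p []      v = mulPoly-0ʳ p
  mulPoly-comm p (a ∷ q) v = begin
    mulPoly p (a · v ⊕ mulX (mulPoly q v))              ≡⟨ mulPoly-⊕ʳ p _ _ ⟩
    mulPoly p (a · v) ⊕ mulPoly p (mulX (mulPoly q v))  ≡⟨ cong₂ _⊕_ (mulPoly-·ʳ p a v) (mulPoly-mulXʳ p _) ⟩
    a · mulPoly p v ⊕ mulX (mulPoly p (mulPoly q v))    ≡⟨ cong (λ z → a · mulPoly p v ⊕ mulX z) (mulPoly-comm p q v) ⟩
    a · mulPoly p v ⊕ mulX (mulPoly q (mulPoly p v))    ∎

  mulPoly-false∷ : ∀ {m} (p : Vec Bool m) v → mulPoly (false ∷ p) v ≡ mulX (mulPoly p v)
  mulPoly-false∷ p v = ⊕-identityˡ _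

  mulPoly-∷ʳ : ∀ {m} (p : Vec Bool m) b v → mulPoly (p ∷ʳ b) v ≡ mulPoly p v ⊕ b · mulX^ m v
  mulPoly-∷ʳ []      b v = trans (cong (b · v ⊕_) mulX-0) (trans (⊕-identityʳ _) (sym (⊕-identityˡ _)))
  mulPoly-∷ʳ {suc m} (a ∷ p) b v = begin
    a · v ⊕ mulX (mulPoly (p ∷ʳ b) v)
      ≡⟨ cong (λ z → a · v ⊕ mulX z) (mulPoly-∷ʳ p b v) ⟩
    a · v ⊕ mulX (mulPoly p v ⊕ b · mulX^ m v)
      ≡⟨ cong (a · v ⊕_) (trans (mulX-⊕ _ _) (cong (mulX (mulPoly p v) ⊕_) (mulX-· b _))) ⟩
    a · v ⊕ (mulX (mulPoly p v) ⊕ b · mulX^ (suc m) v)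
      ≡⟨ ⊕-assoc _ _ _ ⟨
    a · v ⊕ mulX (mulPoly p v) ⊕ b · mulX^ (suc m) v ∎

  mulPoly-oneʳ : ∀ {m} (r : Vec Bool m) (m≤d : m ≤ d) → mulPoly r oneR ≡ padRight m≤d false r
  mulPoly-oneʳ []      z≤n       = refl
  mulPoly-oneʳ (a ∷ r) (s≤s m≤k) = begin
    a · oneR ⊕ mulX (mulPoly r oneR)
      ≡⟨ cong (λ z → a · oneR ⊕ mulX z) (mulPoly-oneʳ r (ℕₚ.m≤n⇒m≤1+n m≤k)) ⟩
    a · oneR ⊕ mulX (padRight (ℕₚ.m≤n⇒m≤1+n m≤k) false r)
      ≡⟨ cong (λ z → a · oneR ⊕ mulX z) (padRight-∷ʳ m≤k false r) ⟩
    a · oneR ⊕ mulX (padRight m≤k false r ∷ʳ false)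
      ≡⟨ cong (a · oneR ⊕_) (trans (mulX-∷ʳ _ false) (⊕-identityʳ _)) ⟩
    a · oneR ⊕ (false ∷ padRight m≤k false r)
      ≡⟨ a·1⊕[0∷v]≡a∷v a _ ⟩
    a ∷ padRight m≤k false r ∎
    where
    a·1⊕[0∷v]≡a∷v : ∀ a (v : Vec Bool k) → a · oneR ⊕ (false ∷ v) ≡ a ∷ v
    a·1⊕[0∷v]≡a∷v false v = ⊕-identityˡ (false ∷ v)
    a·1⊕[0∷v]≡a∷v true  v = cong (true ∷_) (⊕-identityˡ v)

  mulR-identityʳ : ∀ r → mulR r oneR ≡ r
  mulR-identityʳ r = trans (mulPoly-oneʳ r ℕₚ.≤-refl) (padRight-refl false r)

  mulX^k-one : mulX^ k oneR ≡ 0ᵛ ∷ʳ true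
  mulX^k-one = begin
    mulX^ k oneR                                 ≡⟨ ⊕-identityˡ (mulX^ k oneR) ⟨
    0ᵛ ⊕ true · mulX^ k oneR                     ≡⟨ cong (_⊕ mulX^ k oneR) (mulPoly-0ˡ k oneR) ⟨
    mulPoly (0ᵛ {k}) oneR ⊕ true · mulX^ k oneR  ≡⟨ mulPoly-∷ʳ (0ᵛ {k}) true oneR ⟨
    mulPoly (0ᵛ {k} ∷ʳ true) oneR                ≡⟨ mulR-identityʳ (0ᵛ ∷ʳ true) ⟩
    0ᵛ ∷ʳ true                                   ∎

  -- The defining relation x^d = c of A/fA (signs do not matter over F₂).
  mulX^d≡mulPoly-c : ∀ v → mulX^ d v ≡ mulPoly c v
  mulX^d≡mulPoly-c v = begin
    mulX^ d v                   ≡⟨ cong (mulX^ d) (mulR-identityʳ v) ⟨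
    mulX^ d (mulPoly v oneR)    ≡⟨ mulPoly-mulX^ʳ v d oneR ⟨
    mulPoly v (mulX^ d oneR)    ≡⟨ cong (mulPoly v) mulX^d-one ⟩
    mulPoly v c                 ≡⟨ cong (mulPoly v) (mulR-identityʳ c) ⟨
    mulPoly v (mulPoly c oneR)  ≡⟨ mulPoly-comm v c oneR ⟩
    mulPoly c (mulPoly v oneR)  ≡⟨ cong (mulPoly c) (mulR-identityʳ v) ⟩
    mulPoly c v                 ∎
    where
    mulX^d-one : mulX^ d oneR ≡ c
    mulX^d-one = trans (cong mulX mulX^k-one) (trans (mulX-∷ʳ 0ᵛ true) (⊕-identityˡ c))

  f-vanishes : ∀ v → mulPoly (c ∷ʳ true) v ≡ 0ᵛ
  f-vanishes v = begin
    mulPoly (c ∷ʳ true) v      ≡⟨ mulPoly-∷ʳ c true v ⟩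
    mulPoly c v ⊕ mulX^ d v    ≡⟨ cong (mulPoly c v ⊕_) (mulX^d≡mulPoly-c v) ⟩
    mulPoly c v ⊕ mulPoly c v  ≡⟨ v⊕v≡0 (mulPoly c v) ⟩
    0ᵛ                         ∎

  -- For any monic f′ = x^d′ + c′ vanishing in A/fA: with f′ = f this is associativity, and for a
  -- multiple f′ of f it makes the reduction A/f′A → A/fA multiplicative.
  module _ {k′} (c′ : Vec Bool (suc k′)) (f′-vanishes : ∀ v → mulPoly (c′ ∷ʳ true) v ≡ 0ᵛ) where

    mulPoly-mulX-mod : ∀ w v → mulPoly (Quot.mulX c′ w) v ≡ mulX (mulPoly w v)
    mulPoly-mulX-mod w v = begin
      mulPoly (Quot.mulX c′ w) v
        ≡⟨ cong (λ z → mulPoly z v) (mulX-def c′ w) ⟩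
      mulPoly ((false ∷ init w) ⊕ last w · c′) v
        ≡⟨ mulPoly-⊕ˡ (false ∷ init w) (last w · c′) v ⟩
      mulPoly (false ∷ init w) v ⊕ mulPoly (last w · c′) v
        ≡⟨ cong₂ _⊕_ (mulPoly-false∷ (init w) v) (mulPoly-·ˡ (last w) c′ v) ⟩
      mulX (mulPoly (init w) v) ⊕ last w · mulPoly c′ v
        ≡⟨ cong (λ z → mulX (mulPoly (init w) v) ⊕ last w · z) c′≡x^d′ ⟩
      mulX (mulPoly (init w) v) ⊕ last w · mulX (mulX^ k′ v)
        ≡⟨ cong (mulX (mulPoly (init w) v) ⊕_) (mulX-· (last w) _) ⟨
      mulX (mulPoly (init w) v) ⊕ mulX (last w · mulX^ k′ v)
        ≡⟨ mulX-⊕ _ _ ⟨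
      mulX (mulPoly (init w) v ⊕ last w · mulX^ k′ v)
        ≡⟨ cong mulX (mulPoly-∷ʳ (init w) (last w) v) ⟨
      mulX (mulPoly (init w ∷ʳ last w) v)
        ≡⟨ cong (λ z → mulX (mulPoly z v)) (init∷ʳlast w) ⟩
      mulX (mulPoly w v) ∎
      where
      c′≡x^d′ : mulPoly c′ v ≡ mulX^ (suc k′) v
      c′≡x^d′ = ⊕≡0⇒≡ (trans (sym (mulPoly-∷ʳ c′ true v)) (f′-vanishes v))

    mulPoly-mulPoly-mod : ∀ {m} (p : Vec Bool m) s v → mulPoly (Quot.mulPoly c′ p s) v ≡ mulPoly p (mulPoly s v)
    mulPoly-mulPoly-mod []      s v = mulPoly-0ˡ (suc k′) v
    mulPoly-mulPoly-mod (a ∷ p) s v = begin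
      mulPoly (a · s ⊕ Quot.mulX c′ (Quot.mulPoly c′ p s)) v
        ≡⟨ mulPoly-⊕ˡ (a · s) _ v ⟩
      mulPoly (a · s) v ⊕ mulPoly (Quot.mulX c′ (Quot.mulPoly c′ p s)) v
        ≡⟨ cong₂ _⊕_ (mulPoly-·ˡ a s v) (mulPoly-mulX-mod _ v) ⟩
      a · mulPoly s v ⊕ mulX (mulPoly (Quot.mulPoly c′ p s) v)
        ≡⟨ cong (λ z → a · mulPoly s v ⊕ mulX z) (mulPoly-mulPoly-mod p s v) ⟩
      a · mulPoly s v ⊕ mulX (mulPoly p (mulPoly s v)) ∎

  mulR-comm : ∀ r s → mulR r s ≡ mulR s r
  mulR-comm r s = begin
    mulPoly r s                 ≡⟨ cong (mulPoly r) (mulR-identityʳ s) ⟨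
    mulPoly r (mulPoly s oneR)  ≡⟨ mulPoly-comm r s oneR ⟩
    mulPoly s (mulPoly r oneR)  ≡⟨ cong (mulPoly s) (mulR-identityʳ r) ⟩
    mulPoly s r                 ∎

  isCommutativeRing : IsCommutativeRing _≡_ addR mulR id zeroR oneR
  isCommutativeRing = record
    { isRing = record
      { +-isAbelianGroup = ⊕-isAbelianGroup
      ; *-cong           = cong₂ mulR
      ; *-assoc          = mulPoly-mulPoly-mod c f-vanishes
      ; *-identity       = mulPoly-1 k , mulR-identityʳ
      ; distrib          = (λ r u v → mulPoly-⊕ʳ r u v) , (λ r u v → mulPoly-⊕ˡ u v r)
      }
    ; *-comm = mulR-comm
    }

  open CharacteristicTwo isCommutativeRing public
  open CommutativeRing commutativeRing public
    using (_+_; _*_; 0#; 1#; +-comm; *-comm; *-assoc; *-identityˡ; *-identityʳ; zeroˡ; zeroʳ)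
  open CommutativeSemigroupProperties (CommutativeRing.+-commutativeSemigroup commutativeRing)
    using () renaming (xy∙z≈xz∙y to xy+z≡xz+y)
  open CommutativeSemigroupProperties (CommutativeRing.*-commutativeSemigroup commutativeRing) public
    using () renaming (x∙yz≈y∙xz to x*yz≡y*xz)

  ξ : Res
  ξ = mulX 1#

  η : Res
  η = ξ + 1#

  ξ*v≡mulX-v : ∀ v → ξ * v ≡ mulX v
  ξ*v≡mulX-v v = trans (mulPoly-mulX-mod c f-vanishes 1# v) (cong mulX (*-identityˡ v))

  η*v≡mulX-v⊕v : ∀ v → η * v ≡ mulX v ⊕ v
  η*v≡mulX-v⊕v v = trans (mulPoly-⊕ˡ ξ 1# v) (cong₂ _⊕_ (ξ*v≡mulX-v v) (*-identityˡ v))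

  isUnit⇒unit : ∀ {r} → IsUnit r → Unit r
  isUnit⇒unit = satisfied

  unit⇒isUnit : ∀ {r} → Unit r → IsUnit r
  unit⇒isUnit (s , r*s≡1) = Any.map (λ { refl → r*s≡1 }) (∈-allVecs s)

  units-unique : Unique units
  units-unique = filter⁺ isUnit? (allVecs-unique d)

  ∈units⇒unit : ∀ {r} → r ∈ units → Unit r
  ∈units⇒unit {r} r∈units = isUnit⇒unit {r} (proj₂ (∈-filter⁻ isUnit? {xs = allVecs d} r∈units))

  unit⇒∈units : ∀ {r} → Unit r → r ∈ units
  unit⇒∈units {r} unit-r = ∈-filter⁺ isUnit? (∈-allVecs r) (unit⇒isUnit {r} unit-r)

  Φ≡length-filter : ∀ {P : Vec Bool d → Set} (P? : Decidable P) → (∀ r → Unit r ⇔ P r) →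
                    length units ≡ length (filter P? (allVecs d))
  Φ≡length-filter {P} P? unit⇔P = cong length (filter-≐ isUnit? P? (isUnit⊆P , P⊆isUnit) (allVecs d))
    where
    isUnit⊆P : ∀ {r} → IsUnit r → P r
    isUnit⊆P {r} = Equivalence.to (unit⇔P r) ∘ isUnit⇒unit {r}
    P⊆isUnit : ∀ {r} → P r → IsUnit r
    P⊆isUnit {r} = unit⇒isUnit {r} ∘ Equivalence.from (unit⇔P r)

  Φ≡2^m⇒x[x+1]-nilpotent : ∀ {m} → length units ≡ 2 ℕ.^ m → ∃[ N ] (ξ * η) ^ N ≡ 0#
  Φ≡2^m⇒x[x+1]-nilpotent {m} Φ≡2^m = x[x+1]-nilpotent {m} unipotent (allVecs d) ∈-allVecs ξ
    where
    unipotent : ∀ {u} → Unit u → u ^ 2 ℕ.^ m ≡ 1#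
    unipotent {u} unit-u = subst (λ n → u ^ n ≡ 1#) Φ≡2^m (unit^length≡ε units units-unique ∈units⇒unit unit⇒∈units unit-u)

  -- f = x^d + c has f(0) = head c and f(1) = 1 + parity c.

  head-mulX : head c ≡ false → ∀ v → head (mulX v) ≡ false
  head-mulX f[0]≡0 v = begin
    head (mulX v)                         ≡⟨ cong head (mulX-def c v) ⟩
    head ((false ∷ init v) ⊕ last v · c)  ≡⟨ head-⊕ (false ∷ init v) (last v · c) ⟩
    head (last v · c)                     ≡⟨ head-· (last v) c ⟩
    last v ∧ head c                       ≡⟨ cong (last v ∧_) f[0]≡0 ⟩
    last v ∧ false                        ≡⟨ ∧-zeroʳ (last v) ⟩
    false                                 ∎

  head-* : head c ≡ false → ∀ r s → head (r * s) ≡ head r ∧ head s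
  head-* f[0]≡0 (a ∷ r) s = begin
    head (a · s ⊕ mulX (mulPoly r s))           ≡⟨ head-⊕ (a · s) (mulX (mulPoly r s)) ⟩
    head (a · s) xor head (mulX (mulPoly r s))  ≡⟨ cong₂ _xor_ (head-· a s) (head-mulX f[0]≡0 (mulPoly r s)) ⟩
    (a ∧ head s) xor false                      ≡⟨ xor-identityʳ (a ∧ head s) ⟩
    a ∧ head s                                  ∎

  parity-mulX : parity c ≡ true → ∀ v → parity (mulX v) ≡ parity v
  parity-mulX f[1]≡0 v = begin
    parity (mulX v)
      ≡⟨ cong parity (mulX-def c v) ⟩
    parity ((false ∷ init v) ⊕ last v · c)
      ≡⟨ parity-⊕ (false ∷ init v) (last v · c) ⟩
    parity (init v) xor parity (last v · c)
      ≡⟨ cong (parity (init v) xor_) (trans (parity-· (last v) c) (cong (last v ∧_) f[1]≡0)) ⟩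
    parity (init v) xor (last v ∧ true)
      ≡⟨ cong (parity (init v) xor_) (∧-identityʳ (last v)) ⟩
    parity (init v) xor last v
      ≡⟨ parity-∷ʳ (init v) (last v) ⟨
    parity (init v ∷ʳ last v)
      ≡⟨ cong parity (init∷ʳlast v) ⟩
    parity v ∎

  parity-mulPoly : parity c ≡ true → ∀ {m} (p : Vec Bool m) s → parity (mulPoly p s) ≡ parity p ∧ parity s
  parity-mulPoly f[1]≡0 []      s = parity-0 d
  parity-mulPoly f[1]≡0 (a ∷ p) s = begin
    parity (a · s ⊕ mulX (mulPoly p s))
      ≡⟨ parity-⊕ (a · s) (mulX (mulPoly p s)) ⟩
    parity (a · s) xor parity (mulX (mulPoly p s))
      ≡⟨ cong₂ _xor_ (parity-· a s) (trans (parity-mulX f[1]≡0 _) (parity-mulPoly f[1]≡0 p s)) ⟩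
    (a ∧ parity s) xor (parity p ∧ parity s)
      ≡⟨ ∧-distribʳ-xor (parity s) a (parity p) ⟨
    (a xor parity p) ∧ parity s ∎

  unit⇒head≡true : head c ≡ false → ∀ {r} → Unit r → head r ≡ true
  unit⇒head≡true f[0]≡0 {r} (s , r*s≡1) =
    ∧-conicalˡ (head r) (head s) (trans (sym (head-* f[0]≡0 r s)) (cong head r*s≡1))

  unit⇒parity≡true : parity c ≡ true → ∀ {r} → Unit r → parity r ≡ true
  unit⇒parity≡true f[1]≡0 {r} (s , r*s≡1) =
    ∧-conicalˡ (parity r) (parity s) (trans (sym (parity-mulPoly f[1]≡0 r s)) (trans (cong parity r*s≡1) (cong not (parity-0 k))))

  head≡false⇒ξ∣ : ∀ {w} → head w ≡ false → ξ ∣ w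
  head≡false⇒ξ∣ {false ∷ w} _ = w ∷ʳ false , (begin
    (w ∷ʳ false) * ξ         ≡⟨ *-comm (w ∷ʳ false) ξ ⟩
    ξ * (w ∷ʳ false)         ≡⟨ ξ*v≡mulX-v (w ∷ʳ false) ⟩
    mulX (w ∷ʳ false)        ≡⟨ mulX-∷ʳ w false ⟩
    (false ∷ w) ⊕ false · c  ≡⟨ ⊕-identityʳ (false ∷ w) ⟩
    false ∷ w                ∎)

  parity≡false⇒η∣ : ∀ {w} → parity w ≡ false → η ∣ w
  parity≡false⇒η∣ {w} parity-w≡0 with divide-by-x+1 w false false parity-w≡0
  ... | q , w≡ = q ∷ʳ false , (begin
    (q ∷ʳ false) * η                  ≡⟨ *-comm (q ∷ʳ false) η ⟩
    η * (q ∷ʳ false)                  ≡⟨ η*v≡mulX-v⊕v (q ∷ʳ false) ⟩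
    mulX (q ∷ʳ false) ⊕ (q ∷ʳ false)  ≡⟨ cong (_⊕ (q ∷ʳ false)) (trans (mulX-∷ʳ q false) (⊕-identityʳ (false ∷ q))) ⟩
    (false ∷ q) ⊕ (q ∷ʳ false)        ≡⟨ w≡ ⟨
    w                                 ∎)

  head≡false∧parity≡false⇒ξη∣ : ∀ {w} → head w ≡ false → parity w ≡ false → ξ * η ∣ w
  head≡false∧parity≡false⇒ξη∣ {false ∷ w} _ parity-w≡0
    with parity≡false⇒η∣ {w ∷ʳ false} (trans (parity-∷ʳ w false) (trans (xor-identityʳ (parity w)) parity-w≡0))
  ... | t , t*η≡w∷ʳ0 = t , (begin
    t * (ξ * η)        ≡⟨ x*yz≡y*xz t ξ η ⟩
    ξ * (t * η)        ≡⟨ cong (ξ *_) t*η≡w∷ʳ0 ⟩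
    ξ * (w ∷ʳ false)   ≡⟨ ξ*v≡mulX-v (w ∷ʳ false) ⟩
    mulX (w ∷ʳ false)  ≡⟨ trans (mulX-∷ʳ w false) (⊕-identityʳ (false ∷ w)) ⟩
    false ∷ w          ∎)

  f[0]≡1⇒ξ-unit : head c ≡ true → Unit ξ
  f[0]≡1⇒ξ-unit f[0]≡1 = tail c ∷ʳ true , (begin
    ξ * (tail c ∷ʳ true)   ≡⟨ ξ*v≡mulX-v (tail c ∷ʳ true) ⟩
    mulX (tail c ∷ʳ true)  ≡⟨ mulX-∷ʳ (tail c) true ⟩
    (false ∷ tail c) ⊕ c   ≡⟨ [0∷tail-v]⊕v≡1 c f[0]≡1 ⟩
    1#                     ∎)
    where
    [0∷tail-v]⊕v≡1 : ∀ (v : Vec Bool d) → head v ≡ true → (false ∷ tail v) ⊕ v ≡ 1#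
    [0∷tail-v]⊕v≡1 (true ∷ v) refl = cong (true ∷_) (v⊕v≡0 v)

  f[1]≡1⇒η-unit : parity c ≡ false → Unit η
  f[1]≡1⇒η-unit f[1]≡1 with divide-by-x+1 (c ⊕ 1#) false true parity-c⊕1≡1
    where
    parity-c⊕1≡1 : parity (c ⊕ 1#) ≡ false xor true
    parity-c⊕1≡1 = trans (parity-⊕ c 1#) (cong₂ _xor_ f[1]≡1 (cong not (parity-0 k)))
  ... | w , c⊕1≡ = w ∷ʳ true , (begin
    η * (w ∷ʳ true)                 ≡⟨ η*v≡mulX-v⊕v (w ∷ʳ true) ⟩
    mulX (w ∷ʳ true) ⊕ (w ∷ʳ true)  ≡⟨ cong (_⊕ (w ∷ʳ true)) (mulX-∷ʳ w true) ⟩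
    (false ∷ w) ⊕ c ⊕ (w ∷ʳ true)   ≡⟨ xy+z≡xz+y (false ∷ w) c (w ∷ʳ true) ⟩
    (false ∷ w) ⊕ (w ∷ʳ true) ⊕ c   ≡⟨ cong (_⊕ c) c⊕1≡ ⟨
    c ⊕ 1# ⊕ c                      ≡⟨ cong (_⊕ c) (+-comm c 1#) ⟩
    1# ⊕ c ⊕ c                      ≡⟨ x+y+y≡x 1# c ⟩
    1#                              ∎)

  head-[r+1]≡false : ∀ {r} → head r ≡ true → head (r + 1#) ≡ false
  head-[r+1]≡false {true ∷ r} refl = refl

  parity-[r+1]≡false : ∀ {r} → parity r ≡ true → parity (r + 1#) ≡ false
  parity-[r+1]≡false {r} parity-r≡1 = trans (parity-⊕ r 1#) (cong₂ _xor_ parity-r≡1 (cong not (parity-0 k)))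

  unit⇔head≡true : head c ≡ false → ∀ a → ξ ^ a ≡ 0# → ∀ r → Unit r ⇔ head r ≡ true
  unit⇔head≡true f[0]≡0 a ξ^a≡0 r = mk⇔ (unit⇒head≡true f[0]≡0 {r})
    (λ head-r≡1 → x+1-nilpotent⇒unit r a
      (∣-nilpotent a (head≡false⇒ξ∣ {r + 1#} (head-[r+1]≡false {r} head-r≡1)) ξ^a≡0))

  unit⇔parity≡true : parity c ≡ true → ∀ b → η ^ b ≡ 0# → ∀ r → Unit r ⇔ parity r ≡ true
  unit⇔parity≡true f[1]≡0 b η^b≡0 r = mk⇔ (unit⇒parity≡true f[1]≡0 {r})
    (λ parity-r≡1 → x+1-nilpotent⇒unit r b
      (∣-nilpotent b (parity≡false⇒η∣ {r + 1#} (parity-[r+1]≡false {r} parity-r≡1)) η^b≡0))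

  unit⇔head∧parity≡true : head c ≡ false → parity c ≡ true → ∀ a b → ξ ^ a * η ^ b ≡ 0# →
                          ∀ r → Unit r ⇔ (head r ≡ true × parity r ≡ true)
  unit⇔head∧parity≡true f[0]≡0 f[1]≡0 a b ξ^a*η^b≡0 r = mk⇔
    (λ unit-r → unit⇒head≡true f[0]≡0 {r} unit-r , unit⇒parity≡true f[1]≡0 {r} unit-r)
    (λ (head-r≡1 , parity-r≡1) → x+1-nilpotent⇒unit r (a ℕ.+ b) (∣-nilpotent (a ℕ.+ b)
      (head≡false∧parity≡false⇒ξη∣ {r + 1#} (head-[r+1]≡false {r} head-r≡1) (parity-[r+1]≡false {r} parity-r≡1))
      (x^m*y^n≡0⇒[x*y]^[m+n]≡0 a b ξ^a*η^b≡0)))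

-- The polynomials x^a (x+1)^b

infixl 7 _·x _·[x+1]

_·x : MonicNC → MonicNC
(k , c) ·x = suc k , false ∷ c

_·[x+1] : MonicNC → MonicNC
(k , c) ·[x+1] = suc k , (false ∷ c) ⊕ (c ∷ʳ true)

coefficients : (f : MonicNC) → Vec Bool (suc (suc (proj₁ f)))
coefficients (k , c) = c ∷ʳ true

x^_·[x+1]^_ : (a b : ℕ) → .{{NonZero (a ℕ.+ b)}} → MonicNC
x^_·[x+1]^_ zero zero {{()}}
x^ zero        ·[x+1]^ suc zero    = 0 , true ∷ []
x^ zero        ·[x+1]^ suc (suc b) = (x^ zero ·[x+1]^ suc b) ·[x+1]
x^ suc zero    ·[x+1]^ zero        = 0 , false ∷ []
x^ suc zero    ·[x+1]^ suc b       = (x^ zero ·[x+1]^ suc b) ·x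
x^ suc (suc a) ·[x+1]^ b           = (x^ suc a ·[x+1]^ b) ·x

x^[1+a]·[x+1]^b≡x^a·[x+1]^b·x : ∀ a b .{{_ : NonZero (a ℕ.+ b)}} → x^ suc a ·[x+1]^ b ≡ (x^ a ·[x+1]^ b) ·x
x^[1+a]·[x+1]^b≡x^a·[x+1]^b·x zero    (suc b) = refl
x^[1+a]·[x+1]^b≡x^a·[x+1]^b·x (suc a) b       = refl

x^a·[x+1]^b·[x+1]≡x^a·[x+1]^[1+b] : ∀ a b .{{_ : NonZero (a ℕ.+ b)}} →
                                    (x^ a ·[x+1]^ b) ·[x+1] ≡ (x^ a ·[x+1]^ suc b) {{ℕ.≢-nonZero (ℕₚ.m+1+n≢0 a)}}
x^a·[x+1]^b·[x+1]≡x^a·[x+1]^[1+b] zero          (suc b) = refl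
x^a·[x+1]^b·[x+1]≡x^a·[x+1]^[1+b] (suc zero)    zero    = refl
x^a·[x+1]^b·[x+1]≡x^a·[x+1]^[1+b] (suc zero)    (suc b) = refl
x^a·[x+1]^b·[x+1]≡x^a·[x+1]^[1+b] (suc (suc a)) b       = cong _·x (x^a·[x+1]^b·[x+1]≡x^a·[x+1]^[1+b] (suc a) b)

degree-x^a·[x+1]^b : ∀ a b .{{_ : NonZero (a ℕ.+ b)}} → suc (proj₁ (x^ a ·[x+1]^ b)) ≡ a ℕ.+ b
degree-x^a·[x+1]^b zero          (suc zero)    = refl
degree-x^a·[x+1]^b zero          (suc (suc b)) = cong suc (degree-x^a·[x+1]^b zero (suc b))
degree-x^a·[x+1]^b (suc zero)    zero          = refl
degree-x^a·[x+1]^b (suc zero)    (suc b)       = cong suc (degree-x^a·[x+1]^b zero (suc b))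
degree-x^a·[x+1]^b (suc (suc a)) b             = cong suc (degree-x^a·[x+1]^b (suc a) b)

leadingZeros : ∀ {n} → Vec Bool n → ℕ
leadingZeros []          = 0
leadingZeros (false ∷ v) = suc (leadingZeros v)
leadingZeros (true ∷ v)  = 0

valuation : MonicNC → ℕ
valuation (k , c) = leadingZeros c

valuation-·[x+1] : ∀ f → valuation (f ·[x+1]) ≡ valuation f
valuation-·[x+1] (k , c) = leadingZeros-[x+1]· c
  where
  leadingZeros-[x+1]· : ∀ {n} (c : Vec Bool n) → leadingZeros ((false ∷ c) ⊕ (c ∷ʳ true)) ≡ leadingZeros c
  leadingZeros-[x+1]· []          = refl
  leadingZeros-[x+1]· (true ∷ c)  = refl
  leadingZeros-[x+1]· (false ∷ c) = cong suc (leadingZeros-[x+1]· c)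

valuation-x^a·[x+1]^b : ∀ a b .{{_ : NonZero (a ℕ.+ b)}} → valuation (x^ a ·[x+1]^ b) ≡ a
valuation-x^a·[x+1]^b zero          (suc zero)    = refl
valuation-x^a·[x+1]^b zero          (suc (suc b)) = trans (valuation-·[x+1] (x^ zero ·[x+1]^ suc b)) (valuation-x^a·[x+1]^b zero (suc b))
valuation-x^a·[x+1]^b (suc zero)    zero          = refl
valuation-x^a·[x+1]^b (suc zero)    (suc b)       = cong suc (valuation-x^a·[x+1]^b zero (suc b))
valuation-x^a·[x+1]^b (suc (suc a)) b             = cong suc (valuation-x^a·[x+1]^b (suc a) b)

x^a·[x+1]^b-injective : ∀ {a b a′ b′} .{{_ : NonZero (a ℕ.+ b)}} .{{_ : NonZero (a′ ℕ.+ b′)}} →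
                        x^ a ·[x+1]^ b ≡ x^ a′ ·[x+1]^ b′ → a ≡ a′ × b ≡ b′
x^a·[x+1]^b-injective {a} {b} {a′} {b′} f≡f′ = a≡a′ , ℕₚ.+-cancelˡ-≡ a b b′ (begin
  a ℕ.+ b                         ≡⟨ degree-x^a·[x+1]^b a b ⟨
  suc (proj₁ (x^ a ·[x+1]^ b))    ≡⟨ cong (suc ∘ proj₁) f≡f′ ⟩
  suc (proj₁ (x^ a′ ·[x+1]^ b′))  ≡⟨ degree-x^a·[x+1]^b a′ b′ ⟩
  a′ ℕ.+ b′                       ≡⟨ cong (ℕ._+ b′) a≡a′ ⟨
  a ℕ.+ b′                        ∎)
  where
  open ≡-Reasoning
  a≡a′ : a ≡ a′
  a≡a′ = trans (sym (valuation-x^a·[x+1]^b a b)) (trans (cong valuation f≡f′) (valuation-x^a·[x+1]^b a′ b′))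

head-x^[1+a]·[x+1]^b : ∀ a b → head (proj₂ (x^ suc a ·[x+1]^ b)) ≡ false
head-x^[1+a]·[x+1]^b zero    zero    = refl
head-x^[1+a]·[x+1]^b zero    (suc b) = refl
head-x^[1+a]·[x+1]^b (suc a) b       = refl

parity-·[x+1] : ∀ f → parity (proj₂ (f ·[x+1])) ≡ true
parity-·[x+1] (k , c) = begin
  parity ((false ∷ c) ⊕ (c ∷ʳ true))  ≡⟨ parity-⊕ (false ∷ c) (c ∷ʳ true) ⟩
  parity c xor parity (c ∷ʳ true)     ≡⟨ cong (parity c xor_) (parity-∷ʳ c true) ⟩
  parity c xor (parity c xor true)    ≡⟨ xor-cancelˡ (parity c) true ⟩
  true                                ∎
  where open ≡-Reasoning

parity-x^a·[x+1]^[1+b] : ∀ a b .{{_ : NonZero (a ℕ.+ suc b)}} → parity (proj₂ (x^ a ·[x+1]^ suc b)) ≡ true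
parity-x^a·[x+1]^[1+b] zero    zero    = refl
parity-x^a·[x+1]^[1+b] zero    (suc b) = parity-·[x+1] (x^ zero ·[x+1]^ suc b)
parity-x^a·[x+1]^[1+b] (suc a) b       =
  trans (cong (parity ∘ proj₂) (sym (x^a·[x+1]^b·[x+1]≡x^a·[x+1]^[1+b] (suc a) b))) (parity-·[x+1] (x^ suc a ·[x+1]^ b))

module _ {k} (c : Vec Bool (suc k)) where
  open QuotientRing c
  open ≡-Reasoning

  mulPoly-x·p : ∀ {m} (p : Vec Bool m) v → mulPoly (false ∷ p) v ≡ ξ * mulPoly p v
  mulPoly-x·p p v = trans (mulPoly-false∷ p v) (sym (ξ*v≡mulX-v (mulPoly p v)))

  mulPoly-[x+1]·p : ∀ {m} (p : Vec Bool m) v → mulPoly ((false ∷ p) ⊕ (p ∷ʳ false)) v ≡ η * mulPoly p v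
  mulPoly-[x+1]·p p v = begin
    mulPoly ((false ∷ p) ⊕ (p ∷ʳ false)) v
      ≡⟨ mulPoly-⊕ˡ (false ∷ p) (p ∷ʳ false) v ⟩
    mulPoly (false ∷ p) v ⊕ mulPoly (p ∷ʳ false) v
      ≡⟨ cong₂ _⊕_ (mulPoly-false∷ p v) (trans (mulPoly-∷ʳ p false v) (⊕-identityʳ _)) ⟩
    mulX (mulPoly p v) ⊕ mulPoly p v
      ≡⟨ η*v≡mulX-v⊕v (mulPoly p v) ⟨
    η * mulPoly p v ∎

  mulPoly-coefficients-·x : ∀ f v → mulPoly (coefficients (f ·x)) v ≡ ξ * mulPoly (coefficients f) v
  mulPoly-coefficients-·x f v = mulPoly-x·p (coefficients f) v

  mulPoly-coefficients-·[x+1] : ∀ f v → mulPoly (coefficients (f ·[x+1])) v ≡ η * mulPoly (coefficients f) v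
  mulPoly-coefficients-·[x+1] (k , c) v =
    trans (cong (λ p → mulPoly p v) (sym (∷ʳ-⊕ (false ∷ c) (c ∷ʳ true) true false))) (mulPoly-[x+1]·p (c ∷ʳ true) v)

  mulPoly-coefficients-x^a·[x+1]^b : ∀ a b .{{_ : NonZero (a ℕ.+ b)}} v →
                                     mulPoly (coefficients (x^ a ·[x+1]^ b)) v ≡ ξ ^ a * (η ^ b * v)
  mulPoly-coefficients-x^a·[x+1]^b zero (suc zero) v = begin
    mulPoly (true ∷ true ∷ []) v  ≡⟨ mulPoly-[x+1]·p (true ∷ []) v ⟩
    η * mulPoly (true ∷ []) v     ≡⟨ cong (η *_) (mulPoly-1 0 v) ⟩
    η * v                         ≡⟨ cong (_* v) (*-identityʳ η) ⟨
    η ^ 1 * v                     ≡⟨ *-identityˡ (η ^ 1 * v) ⟨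
    ξ ^ 0 * (η ^ 1 * v)           ∎
  mulPoly-coefficients-x^a·[x+1]^b zero (suc (suc b)) v = begin
    mulPoly (coefficients (x^ 0 ·[x+1]^ suc b ·[x+1])) v  ≡⟨ mulPoly-coefficients-·[x+1] (x^ 0 ·[x+1]^ suc b) v ⟩
    η * mulPoly (coefficients (x^ 0 ·[x+1]^ suc b)) v     ≡⟨ cong (η *_) (mulPoly-coefficients-x^a·[x+1]^b zero (suc b) v) ⟩
    η * (ξ ^ 0 * (η ^ suc b * v))                         ≡⟨ x*yz≡y*xz η (ξ ^ 0) (η ^ suc b * v) ⟩
    ξ ^ 0 * (η * (η ^ suc b * v))                         ≡⟨ cong (ξ ^ 0 *_) (*-assoc η (η ^ suc b) v) ⟨
    ξ ^ 0 * (η ^ suc (suc b) * v)                         ∎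
  mulPoly-coefficients-x^a·[x+1]^b (suc zero) zero v = begin
    mulPoly (false ∷ true ∷ []) v  ≡⟨ mulPoly-x·p (true ∷ []) v ⟩
    ξ * mulPoly (true ∷ []) v      ≡⟨ cong (ξ *_) (mulPoly-1 0 v) ⟩
    ξ * v                          ≡⟨ cong₂ _*_ (*-identityʳ ξ) (*-identityˡ v) ⟨
    ξ ^ 1 * (η ^ 0 * v)            ∎
  mulPoly-coefficients-x^a·[x+1]^b (suc zero) (suc b) v = begin
    mulPoly (coefficients (x^ 0 ·[x+1]^ suc b ·x)) v   ≡⟨ mulPoly-coefficients-·x (x^ 0 ·[x+1]^ suc b) v ⟩
    ξ * mulPoly (coefficients (x^ 0 ·[x+1]^ suc b)) v  ≡⟨ cong (ξ *_) (mulPoly-coefficients-x^a·[x+1]^b zero (suc b) v) ⟩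
    ξ * (ξ ^ 0 * (η ^ suc b * v))                      ≡⟨ *-assoc ξ (ξ ^ 0) (η ^ suc b * v) ⟨
    ξ ^ 1 * (η ^ suc b * v)                            ∎
  mulPoly-coefficients-x^a·[x+1]^b (suc (suc a)) b v = begin
    mulPoly (coefficients (x^ suc a ·[x+1]^ b ·x)) v   ≡⟨ mulPoly-coefficients-·x (x^ suc a ·[x+1]^ b) v ⟩
    ξ * mulPoly (coefficients (x^ suc a ·[x+1]^ b)) v  ≡⟨ cong (ξ *_) (mulPoly-coefficients-x^a·[x+1]^b (suc a) b v) ⟩
    ξ * (ξ ^ suc a * (η ^ b * v))                      ≡⟨ *-assoc ξ (ξ ^ suc a) (η ^ b * v) ⟨
    ξ ^ suc (suc a) * (η ^ b * v)                      ∎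

ξ^a*η^b≡0 : ∀ a b .{{_ : NonZero (a ℕ.+ b)}} → let open QuotientRing (proj₂ (x^ a ·[x+1]^ b)) in ξ ^ a * η ^ b ≡ 0#
ξ^a*η^b≡0 a b = begin
  ξ ^ a * η ^ b                               ≡⟨ cong (ξ ^ a *_) (*-identityʳ (η ^ b)) ⟨
  ξ ^ a * (η ^ b * 1#)                        ≡⟨ mulPoly-coefficients-x^a·[x+1]^b c a b 1# ⟨
  mulPoly (coefficients (x^ a ·[x+1]^ b)) 1#  ≡⟨ f-vanishes 1# ⟩
  0#                                          ∎
  where
  c = proj₂ (x^ a ·[x+1]^ b)
  open QuotientRing c
  open ≡-Reasoning

-- Nilpotence of x(x+1) forces f = x^a (x+1)^b

x[x+1]-Nilpotent : MonicNC → Set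
x[x+1]-Nilpotent (k , c) = let open QuotientRing c in ∃[ N ] (ξ * η) ^ N ≡ 0#

-- Reduction modulo a divisor g of f: let r act on 1 in A/gA.
module Reduction {kf kg} (cf : Vec Bool (suc kf)) (cg : Vec Bool (suc kg))
                 (f-vanishes : ∀ v → QuotientRing.mulPoly cg (cf ∷ʳ true) v ≡ 0ᵛ) where
  private
    module F = QuotientRing cf
    module G = QuotientRing cg
  open ≡-Reasoning

  reduce : F.Res → G.Res
  reduce r = G.mulPoly r G.1#

  reduce-1 : reduce F.1# ≡ G.1#
  reduce-1 = G.mulPoly-1 kf G.1#

  reduce-* : ∀ r s → reduce (r F.* s) ≡ reduce r G.* reduce s
  reduce-* r s = begin
    G.mulPoly (F.mulPoly r s) G.1#   ≡⟨ G.mulPoly-mulPoly-mod cf f-vanishes r s G.1# ⟩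
    G.mulPoly r (reduce s)           ≡⟨ cong (G.mulPoly r) (G.*-identityˡ (reduce s)) ⟨
    G.mulPoly r (G.1# G.* reduce s)  ≡⟨ G.mulPoly-mulPoly-mod cg G.f-vanishes r G.1# (reduce s) ⟨
    reduce r G.* reduce s            ∎

  reduce-^ : ∀ r n → reduce (r F.^ n) ≡ reduce r G.^ n
  reduce-^ r zero    = reduce-1
  reduce-^ r (suc n) = trans (reduce-* r (r F.^ n)) (cong (reduce r G.*_) (reduce-^ r n))

  reduce-ξ : reduce F.ξ ≡ G.ξ
  reduce-ξ = trans (G.mulPoly-mulX-mod cf f-vanishes F.1# G.1#) (cong G.mulX reduce-1)

  reduce-ξη : reduce (F.ξ F.* F.η) ≡ G.ξ G.* G.η
  reduce-ξη = trans (reduce-* F.ξ F.η) (cong₂ G._*_ reduce-ξ reduce-η)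
    where
    reduce-η : reduce F.η ≡ G.η
    reduce-η = trans (G.mulPoly-⊕ˡ F.ξ F.1# G.1#) (cong₂ _⊕_ reduce-ξ reduce-1)

  x[x+1]-nilpotent-descends : x[x+1]-Nilpotent (kf , cf) → x[x+1]-Nilpotent (kg , cg)
  x[x+1]-nilpotent-descends (N , [ξη]^N≡0) = N , (begin
    (G.ξ G.* G.η) G.^ N           ≡⟨ cong (G._^ N) reduce-ξη ⟨
    reduce (F.ξ F.* F.η) G.^ N    ≡⟨ reduce-^ (F.ξ F.* F.η) N ⟨
    reduce ((F.ξ F.* F.η) F.^ N)  ≡⟨ cong reduce [ξη]^N≡0 ⟩
    reduce F.0#                   ≡⟨ G.mulPoly-0ˡ (suc kf) G.1# ⟩
    G.0#                          ∎)

·x-nilpotent⇒nilpotent : ∀ f → x[x+1]-Nilpotent (f ·x) → x[x+1]-Nilpotent f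
·x-nilpotent⇒nilpotent f@(k , c) = Reduction.x[x+1]-nilpotent-descends (false ∷ c) c f·x-vanishes
  where
  open QuotientRing c
  f·x-vanishes : ∀ v → mulPoly (coefficients (f ·x)) v ≡ 0ᵛ
  f·x-vanishes v = trans (mulPoly-coefficients-·x c f v) (trans (cong (ξ *_) (f-vanishes v)) (zeroʳ ξ))

·[x+1]-nilpotent⇒nilpotent : ∀ f → x[x+1]-Nilpotent (f ·[x+1]) → x[x+1]-Nilpotent f
·[x+1]-nilpotent⇒nilpotent f@(k , c) = Reduction.x[x+1]-nilpotent-descends (proj₂ (f ·[x+1])) c f·[x+1]-vanishes
  where
  open QuotientRing c
  f·[x+1]-vanishes : ∀ v → mulPoly (coefficients (f ·[x+1])) v ≡ 0ᵛ
  f·[x+1]-vanishes v = trans (mulPoly-coefficients-·[x+1] c f v) (trans (cong (η *_) (f-vanishes v)) (zeroʳ η))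

f[0]≡1⇒f[1]≡1⇒¬nilpotent : ∀ {k} {c : Vec Bool (suc k)} → head c ≡ true → parity c ≡ false → ¬ x[x+1]-Nilpotent (k , c)
f[0]≡1⇒f[1]≡1⇒¬nilpotent {c = c} f[0]≡1 f[1]≡1 (N , [ξη]^N≡0) =
  unit⇒¬nilpotent (λ ()) N (∙-unit {ξ} {η} (f[0]≡1⇒ξ-unit f[0]≡1) (f[1]≡1⇒η-unit f[1]≡1)) [ξη]^N≡0
  where open QuotientRing c

f[1]≡0⇒x+1∣f : ∀ {k} (c : Vec Bool (suc (suc k))) → parity c ≡ true → ∃[ g ] (suc k , c) ≡ (k , g) ·[x+1]
f[1]≡0⇒x+1∣f c f[1]≡0 with divide-by-x+1 c false true f[1]≡0
... | g , c≡ = g , cong (_ ,_) c≡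

x[x+1]-nilpotent⇒x^a·[x+1]^b : ∀ k (c : Vec Bool (suc k)) → x[x+1]-Nilpotent (k , c) →
                                 ∃₂ λ a b → Σ[ nz ∈ NonZero (a ℕ.+ b) ] (k , c) ≡ (x^ a ·[x+1]^ b) {{nz}}
x[x+1]-nilpotent⇒x^a·[x+1]^b zero    (false ∷ []) _ = 1 , 0 , _ , refl
x[x+1]-nilpotent⇒x^a·[x+1]^b zero    (true ∷ [])  _ = 0 , 1 , _ , refl
x[x+1]-nilpotent⇒x^a·[x+1]^b (suc k) (false ∷ c) nilpotent
  with x[x+1]-nilpotent⇒x^a·[x+1]^b k c (·x-nilpotent⇒nilpotent (k , c) nilpotent)
... | a , b , nz , g≡ = suc a , b , _ , trans (cong _·x g≡) (sym (x^[1+a]·[x+1]^b≡x^a·[x+1]^b·x a b {{nz}}))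
x[x+1]-nilpotent⇒x^a·[x+1]^b (suc k) (true ∷ c) nilpotent with parity (true ∷ c) in parity≡
... | false = ⊥-elim (f[0]≡1⇒f[1]≡1⇒¬nilpotent refl parity≡ nilpotent)
... | true with f[1]≡0⇒x+1∣f (true ∷ c) parity≡
...   | g , f≡g·[x+1]
      with x[x+1]-nilpotent⇒x^a·[x+1]^b k g (·[x+1]-nilpotent⇒nilpotent (k , g) (subst x[x+1]-Nilpotent f≡g·[x+1] nilpotent))
...   | a , b , nz , g≡ = a , suc b , ℕ.≢-nonZero (ℕₚ.m+1+n≢0 a) ,
        trans f≡g·[x+1] (trans (cong _·[x+1] g≡) (x^a·[x+1]^b·[x+1]≡x^a·[x+1]^[1+b] a b {{nz}}))

-- The totient of x^a (x+1)^b

Φ-x^a·[x+1]^b : ∀ a b .{{_ : NonZero (a ℕ.+ b)}} → Φ (x^ a ·[x+1]^ b) ≡ 2 ℕ.^ ((a ℕ.∸ 1) ℕ.+ (b ℕ.∸ 1))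
Φ-x^a·[x+1]^b zero (suc b) = begin
  length units
    ≡⟨ Φ≡length-filter (λ v → parity v ≟ᵇ true) (unit⇔parity≡true f[1]≡0 (suc b) η^[1+b]≡0) ⟩
  length (filter (λ v → parity v ≟ᵇ true) (allVecs (suc k)))
    ≡⟨ length-filter-parity≡ k true ⟩
  2 ℕ.^ k
    ≡⟨ cong (2 ℕ.^_) (ℕₚ.suc-injective (degree-x^a·[x+1]^b zero (suc b))) ⟩
  2 ℕ.^ b ∎
  where
  k = proj₁ (x^ zero ·[x+1]^ suc b)
  c = proj₂ (x^ zero ·[x+1]^ suc b)
  open QuotientRing c
  open ≡-Reasoning
  f[1]≡0 : parity c ≡ true
  f[1]≡0 = parity-x^a·[x+1]^[1+b] zero b
  η^[1+b]≡0 : η ^ suc b ≡ 0#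
  η^[1+b]≡0 = trans (sym (*-identityˡ (η ^ suc b))) (ξ^a*η^b≡0 zero (suc b))
Φ-x^a·[x+1]^b (suc a) zero = begin
  length units
    ≡⟨ Φ≡length-filter (λ v → head v ≟ᵇ true) (unit⇔head≡true f[0]≡0 (suc a) ξ^[1+a]≡0) ⟩
  length (filter (λ v → head v ≟ᵇ true) (allVecs (suc k)))
    ≡⟨ length-filter-head≡true k ⟩
  2 ℕ.^ k
    ≡⟨ cong (2 ℕ.^_) (ℕₚ.suc-injective (degree-x^a·[x+1]^b (suc a) zero)) ⟩
  2 ℕ.^ (a ℕ.+ 0) ∎
  where
  k = proj₁ (x^ suc a ·[x+1]^ zero)
  c = proj₂ (x^ suc a ·[x+1]^ zero)
  open QuotientRing c
  open ≡-Reasoning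
  f[0]≡0 : head c ≡ false
  f[0]≡0 = head-x^[1+a]·[x+1]^b a zero
  ξ^[1+a]≡0 : ξ ^ suc a ≡ 0#
  ξ^[1+a]≡0 = trans (sym (*-identityʳ (ξ ^ suc a))) (ξ^a*η^b≡0 (suc a) zero)
Φ-x^a·[x+1]^b (suc a) (suc b) = begin
  length units
    ≡⟨ Φ≡length-filter P? (unit⇔head∧parity≡true f[0]≡0 f[1]≡0 (suc a) (suc b) (ξ^a*η^b≡0 (suc a) (suc b))) ⟩
  length (filter P? (allVecs (suc k)))
    ≡⟨ cong (λ n → length (filter P? (allVecs (suc n)))) k≡1+a+b ⟩
  length (filter P? (allVecs (suc (suc (a ℕ.+ b)))))
    ≡⟨ length-filter-head∧parity≡true (a ℕ.+ b) ⟩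
  2 ℕ.^ (a ℕ.+ b) ∎
  where
  k = proj₁ (x^ suc a ·[x+1]^ suc b)
  c = proj₂ (x^ suc a ·[x+1]^ suc b)
  open QuotientRing c
  open ≡-Reasoning
  P? : ∀ {n} → Decidable {A = Vec Bool (suc n)} (λ v → head v ≡ true × parity v ≡ true)
  P? v = (head v ≟ᵇ true) ×-dec (parity v ≟ᵇ true)
  f[0]≡0 : head c ≡ false
  f[0]≡0 = head-x^[1+a]·[x+1]^b a (suc b)
  f[1]≡0 : parity c ≡ true
  f[1]≡0 = parity-x^a·[x+1]^[1+b] (suc a) b
  k≡1+a+b : k ≡ suc (a ℕ.+ b)
  k≡1+a+b = trans (ℕₚ.suc-injective (degree-x^a·[x+1]^b (suc a) (suc b))) (ℕₚ.+-suc a b)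

-- The fibre of Φ over 2^m

2^-injective : ∀ {m n} → 2 ℕ.^ m ≡ 2 ℕ.^ n → m ≡ n
2^-injective {m} {n} 2^m≡2^n with ℕₚ.<-cmp m n
... | tri< m<n _ _ = ⊥-elim (ℕₚ.<-irrefl 2^m≡2^n (ℕₚ.^-monoʳ-< 2 (s≤s (s≤s z≤n)) m<n))
... | tri≈ _ m≡n _ = m≡n
... | tri> _ _ n<m = ⊥-elim (ℕₚ.<-irrefl (sym 2^m≡2^n) (ℕₚ.^-monoʳ-< 2 (s≤s (s≤s z≤n)) n<m))

x^[1+i]·[x+1]^[1+m∸i] : ℕ → ℕ → MonicNC
x^[1+i]·[x+1]^[1+m∸i] m i = x^ suc i ·[x+1]^ suc (m ℕ.∸ i)

-- The exponent pairs with (a - 1)⁺ + (b - 1)⁺ = m.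
Φ⁻¹[2^_] : ℕ → List MonicNC
Φ⁻¹[2^ m ] = x^ 0 ·[x+1]^ suc m ∷ x^ suc m ·[x+1]^ 0 ∷ map (x^[1+i]·[x+1]^[1+m∸i] m) (upTo (suc m))

length-Φ⁻¹[2^m] : ∀ m → length Φ⁻¹[2^ m ] ≡ 3 ℕ.+ m
length-Φ⁻¹[2^m] m = cong (suc ∘ suc) (trans (length-map _ (upTo (suc m))) (length-upTo (suc m)))

Φ⁻¹[2^m]-unique : ∀ m → Unique Φ⁻¹[2^ m ]
Φ⁻¹[2^m]-unique m =
    (0≢1+ ∘ proj₁ ∘ x^a·[x+1]^b-injective
      ∷ All-map⁺ (universal (λ _ → 0≢1+ ∘ proj₁ ∘ x^a·[x+1]^b-injective) (upTo (suc m))))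
  ∷ All-map⁺ (universal (λ _ → 0≢1+ ∘ proj₂ ∘ x^a·[x+1]^b-injective) (upTo (suc m)))
  ∷ Unique-map⁺ (ℕₚ.suc-injective ∘ proj₁ ∘ x^a·[x+1]^b-injective) (upTo⁺ (suc m))
  where
  0≢1+ : ∀ {n} → 0 ≢ suc n
  0≢1+ ()

∈Φ⁻¹[2^m]⇒Φ≡2^m : ∀ m {f} → f ∈ Φ⁻¹[2^ m ] → Φ f ≡ 2 ℕ.^ m
∈Φ⁻¹[2^m]⇒Φ≡2^m m (here refl)         = Φ-x^a·[x+1]^b 0 (suc m)
∈Φ⁻¹[2^m]⇒Φ≡2^m m (there (here refl)) = trans (Φ-x^a·[x+1]^b (suc m) 0) (cong (2 ℕ.^_) (ℕₚ.+-identityʳ m))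
∈Φ⁻¹[2^m]⇒Φ≡2^m m (there (there f∈)) with ∈-map⁻ (x^[1+i]·[x+1]^[1+m∸i] m) f∈
... | i , i∈upTo , refl =
  trans (Φ-x^a·[x+1]^b (suc i) (suc (m ℕ.∸ i))) (cong (2 ℕ.^_) (ℕₚ.m+[n∸m]≡n (ℕₚ.≤-pred (∈-upTo⁻ i∈upTo))))

x^a·[x+1]^b∈Φ⁻¹[2^m] : ∀ m a b .{{_ : NonZero (a ℕ.+ b)}} →
                       (a ℕ.∸ 1) ℕ.+ (b ℕ.∸ 1) ≡ m → x^ a ·[x+1]^ b ∈ Φ⁻¹[2^ m ]
x^a·[x+1]^b∈Φ⁻¹[2^m] m zero    (suc b) refl  = here refl
x^a·[x+1]^b∈Φ⁻¹[2^m] m (suc a) zero    a+0≡m =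
  there (here (cong (λ n → x^ suc n ·[x+1]^ 0) (trans (sym (ℕₚ.+-identityʳ a)) a+0≡m)))
x^a·[x+1]^b∈Φ⁻¹[2^m] m (suc a) (suc b) refl  =
  there (there (subst (_∈ map (x^[1+i]·[x+1]^[1+m∸i] (a ℕ.+ b)) (upTo (suc (a ℕ.+ b))))
                      (cong (λ n → x^ suc a ·[x+1]^ suc n) (ℕₚ.m+n∸m≡n a b))
                      (∈-map⁺ (x^[1+i]·[x+1]^[1+m∸i] (a ℕ.+ b)) (∈-upTo⁺ (s≤s (ℕₚ.m≤m+n a b))))))

Φ≡2^m⇒∈Φ⁻¹[2^m] : ∀ m f → Φ f ≡ 2 ℕ.^ m → f ∈ Φ⁻¹[2^ m ]
Φ≡2^m⇒∈Φ⁻¹[2^m] m f@(k , c) Φ≡2^m =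
  ∈Φ⁻¹ (x[x+1]-nilpotent⇒x^a·[x+1]^b k c (QuotientRing.Φ≡2^m⇒x[x+1]-nilpotent c {m} Φ≡2^m))
  where
  ∈Φ⁻¹ : (∃₂ λ a b → Σ[ nz ∈ NonZero (a ℕ.+ b) ] f ≡ (x^ a ·[x+1]^ b) {{nz}}) → f ∈ Φ⁻¹[2^ m ]
  ∈Φ⁻¹ (a , b , nz , f≡) = subst (_∈ Φ⁻¹[2^ m ]) (sym f≡) (x^a·[x+1]^b∈Φ⁻¹[2^m] m a b {{nz}}
    (2^-injective {n = m} (trans (sym (Φ-x^a·[x+1]^b a b {{nz}})) (trans (cong Φ (sym f≡)) Φ≡2^m))))

mainTheorem6 : (l : ℕ) → 3 ≤ l →
    ∃[ n ] (1 ≤ n × ∃[ fs ] (Unique {A = MonicNC} fs × length fs ≡ l ×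
    ((f : MonicNC) → (f ∈ fs → Φ f ≡ n) × (Φ f ≡ n → f ∈ fs))))
mainTheorem6 l 3≤l =
  2 ℕ.^ m , ℕₚ.m^n>0 2 m , Φ⁻¹[2^ m ] , Φ⁻¹[2^m]-unique m , trans (length-Φ⁻¹[2^m] m) (ℕₚ.m+[n∸m]≡n 3≤l) ,
  λ f → ∈Φ⁻¹[2^m]⇒Φ≡2^m m , Φ≡2^m⇒∈Φ⁻¹[2^m] m f
  where
  m = l ℕ.∸ 3
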